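{- Let $m,f$ be odd integers with $|f|\le m$, and let $a_{m,f}:=|A_{m,f}|$. Then (a) $a_{m,-f}=a_{m,f}$; and (b) if $f\ge 3$ then \[ \frac{a_{m,f}}{\binom{m}{(m+f)/2}}\le\frac{a_{m,f-2}}{\binom{m}{(m+f-2)/2}}\le\frac{a_{m,1}}{\binom{m}{(m+1)/2}}=\frac{\operatorname{RT}(m+2)}{\binom{m+1}{(m+1)/2}}. \]
   Context: $A_{m,f}$ is the set of digraphs on the vertex set $V\cup\{s,t\}$, where $V$ is a fixed labelled set of $m$ vertices and $s,t\notin V$ are two special vertices, such that: there is no arc between $s$ and $t$; between each other pair of distinct vertices there is exactly one arc (in one of the two directions); every $v\in V$ has in-degree equal to out-degree; $d^+(s)=d^-(t)=\frac{m+f}{2}$ and $d^-(s)=d^+(t)=\frac{m-f}{2}$, where $d^+,d^-$ denote out- and in-degree. $\operatorname{RT}(k)$ is the number of regular tournaments on $k$ labelled vertices ($k$ odd). -}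

module Defs where

open import Data.Nat as ℕ using (ℕ; zero; suc; _+_; _*_; _/_)
open import Data.Fin as Fin using (Fin; zero; suc)
open import Data.Bool using (Bool; true; false; _∧_; not; _xor_; if_then_else_)
open import Data.List using (List; []; _∷_; [_]; map; concatMap; length; filterᵇ)
open import Data.Integer as ℤ using (ℤ; +_; ∣_∣)
open import Relation.Nullary using (does)

_∷ᶠ_ : {A : Set} {n : ℕ} → A → (Fin n → A) → Fin (suc n) → A
(x ∷ᶠ g) zero = x
(x ∷ᶠ g) (suc i) = g i

allFns : {A : Set} (n : ℕ) → List A → List (Fin n → A)
allFns zero xs = [ (λ ()) ]
allFns (suc n) xs = concatMap (λ x → map (x ∷ᶠ_) (allFns n xs)) xs

countFin : (n : ℕ) → (Fin n → Bool) → ℕ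
countFin zero p = 0
countFin (suc n) p = (if p zero then 1 else 0) + countFin n (λ i → p (suc i))

allFin : (n : ℕ) → (Fin n → Bool) → Bool
allFin zero p = true
allFin (suc n) p = p zero ∧ allFin n (λ i → p (suc i))

-- A digraph on the labelled vertex set Fin n: D u v = true iff there is an arc u → v.
Digraph : ℕ → Set
Digraph n = Fin n → Fin n → Bool

allDigraphs : (n : ℕ) → List (Digraph n)
allDigraphs n = allFns n (allFns n (true ∷ false ∷ []))

outdeg : {n : ℕ} → Digraph n → Fin n → ℕ
outdeg {n} D u = countFin n (λ v → D u v)

indeg : {n : ℕ} → Digraph n → Fin n → ℕ
indeg {n} D v = countFin n (λ u → D u v)

isTournament : (n : ℕ) → Digraph n → Bool
isTournament n D = allFin n (λ u → allFin n (λ v →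
  if does (u Fin.≟ v) then not (D u u) else (D u v xor D v u)))

isRegular : (n : ℕ) → Digraph n → Bool
isRegular n D = allFin n (λ v → does (outdeg D v ℕ.≟ indeg D v))

RT : ℕ → ℕ
RT k = length (filterᵇ (λ D → isTournament k D ∧ isRegular k D) (allDigraphs k))

-- Vertex set V ∪ {s,t} encoded as Fin (2 + m): s = zero, t = suc zero,
-- and v ∈ V = Fin m is encoded as suc (suc v).
sV : {m : ℕ} → Fin (2 + m)
sV = zero

tV : {m : ℕ} → Fin (2 + m)
tV = suc zero

isST : {m : ℕ} → Fin (2 + m) → Fin (2 + m) → Bool
isST zero (suc zero) = true
isST (suc zero) zero = true
isST _ _ = false

isA : (m : ℕ) → ℤ → Digraph (2 + m) → Bool
isA m f D =
  allFin (2 + m) (λ u → allFin (2 + m) (λ v →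
    if does (u Fin.≟ v) then not (D u u)
    else (if isST u v then not (D u v) ∧ not (D v u) else (D u v xor D v u))))
  ∧ allFin m (λ v → does (outdeg D (suc (suc v)) ℕ.≟ indeg D (suc (suc v))))
  ∧ does (+ (2 * outdeg D sV) ℤ.≟ + m ℤ.+ f)
  ∧ does (+ (2 * indeg D tV) ℤ.≟ + m ℤ.+ f)
  ∧ does (+ (2 * indeg D sV) ℤ.≟ + m ℤ.- f)
  ∧ does (+ (2 * outdeg D tV) ℤ.≟ + m ℤ.- f)

a : ℕ → ℤ → ℕ
a m f = length (filterᵇ (isA m f) (allDigraphs (2 + m)))

-- (m + f) / 2 as a natural number (used when |f| ≤ m, m + f even).
half : ℕ → ℤ → ℕ
half m f = ∣ + m ℤ.+ f ∣ / 2

-- A digraph in A_{m,f} is a tournament T on V together with, for each v ∈ V, the arcs joining v to s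
-- and to t. Then v is balanced exactly when d⁺_T(v) − d⁻_T(v) is 2 and s → v ← t, or it is −2 and
-- s ← v → t, or it is 0 and v receives exactly one of the two arcs. If T has p, q and z vertices of
-- these three kinds (and no other), the choices with d⁺(s) = d⁻(t) = h = (m + f)/2 number
-- binom z (h − p) when p = q, so that z + 2p = m, and none otherwise; so a_{m,f} is a sum of such
-- terms over all tournaments T. Each term is unchanged when h is replaced by m − h, which is (a).
-- By absorption, binom z (j + 1) / binom z j ≤ binom m (p + j + 1) / binom m (p + j) as soon as
-- p + j ≥ (m + 1)/2, and multiplying these ratios gives the inequalities of (b). Finally a regular
-- tournament on V ∪ {s,t} is such a digraph plus an arc between s and t, which makes d⁺(s) inside V
-- equal to (m − 1)/2 or (m + 1)/2; so RT(m + 2) = a_{m,−1} + a_{m,1} = 2 a_{m,1}, while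
-- binom (m + 1) ((m + 1)/2) = 2 binom m ((m + 1)/2).

module Submission where

open import Data.Bool using (Bool; true; false; if_then_else_; _∧_; not; _xor_; T)
open import Data.Bool.Properties using (∧-zeroʳ; ∧-assoc; ∧-comm; not-¬; xor-inverseˡ; xor-inverseʳ)
open import Data.Empty using (⊥-elim)
open import Data.Fin as Fin using (Fin; zero; suc)
import Data.Integer as ℤ
import Data.Integer.Properties as ℤ
import Data.Integer.Tactic.RingSolver as ℤ-Solver
open import Data.List using (List; []; _∷_; map; concatMap; length; filterᵇ; _++_)
open import Data.Nat as ℕ
  using (ℕ; zero; suc; _+_; _*_; _∸_; _≤_; _<_; _≤′_; z≤n; s≤s; s≤s⁻¹; z<s; _≡ᵇ_; _%_; _/_)
open import Data.Nat.Combinatorics using (_C_; nCk+nC[k+1]≡[n+1]C[k+1]; nCk≡nC[n∸k])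
open import Data.Nat.Combinatorics.Specification using (k>n⇒nCk≡0)
open import Data.Nat.DivMod using (%-distribˡ-+; m≡m%n+[m/n]*n; m%n<n; m*n/n≡m; [m+n]%n≡m%n)
open import Data.Nat.Properties
open import Data.Nat.Tactic.RingSolver using (solve-∀; solve)
open import Data.Product using (_×_; _,_; proj₁; proj₂; ∃)
open import Data.Unit using (tt)
open import Function using (_∘_)
open import Relation.Binary.PropositionalEquality
open import Relation.Nullary using (yes; no; ¬_; does)

open import Defs

ι : Bool → ℕ
ι b = if b then 1 else 0

ι-∧ : ∀ a b → ι (a ∧ b) ≡ ι a * ι b
ι-∧ true b = sym (+-identityʳ (ι b))
ι-∧ false b = refl

ι-∧-assoc : ∀ a b c → ι ((a ∧ b) ∧ c) ≡ (if a then ι (b ∧ c) else 0)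
ι-∧-assoc true b c = refl
ι-∧-assoc false b c = refl

-- How a loop at t makes isA or isTournament false: the pairs (s, v) are checked first and stay symbolic.
ι-∧-false : ∀ x r → ι ((x ∧ false) ∧ r) ≡ 0
ι-∧-false true r = refl
ι-∧-false false r = refl

ι≡0 : ∀ b → ¬ (b ≡ true) → ι b ≡ 0
ι≡0 true b≢true = ⊥-elim (b≢true refl)
ι≡0 false _ = refl

∧-true : ∀ {a b} → a ∧ b ≡ true → a ≡ true × b ≡ true
∧-true {true} b≡true = refl , b≡true

∧-absorb : ∀ {p q p′ q′} → (p ≡ true → p′ ≡ true) → (q ≡ true → q′ ≡ true) →
  p ∧ (q ∧ (p′ ∧ q′)) ≡ p ∧ q
∧-absorb {false} _ _ = refl
∧-absorb {true} {false} _ _ = refl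
∧-absorb {true} {true} p⇒p′ q⇒q′ rewrite p⇒p′ refl | q⇒q′ refl = refl

∧-rotate : ∀ p q b → p ∧ (q ∧ b) ≡ b ∧ (p ∧ q)
∧-rotate p q b = trans (sym (∧-assoc p q b)) (∧-comm (p ∧ q) b)

xor-true : ∀ x y → x xor y ≡ true → not x ≡ y
xor-true true false _ = refl
xor-true false true _ = refl

pointwise : {f g : Bool → Bool → Bool} → f true true ≡ g true true → f true false ≡ g true false →
  f false true ≡ g false true → f false false ≡ g false false → ∀ x y → f x y ≡ g x y
pointwise p q r s true true = p
pointwise p q r s true false = q
pointwise p q r s false true = r
pointwise p q r s false false = s

≡ᵇ-true⇒≡ : ∀ a b → (a ≡ᵇ b) ≡ true → a ≡ b
≡ᵇ-true⇒≡ a b a≡ᵇb = ≡ᵇ⇒≡ a b (subst T (sym a≡ᵇb) tt)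

≡ᵇ-refl : ∀ a → (a ≡ᵇ a) ≡ true
≡ᵇ-refl zero = refl
≡ᵇ-refl (suc a) = ≡ᵇ-refl a

≡ᵇ-cong-⇔ : ∀ a b c d → (a ≡ b → c ≡ d) → (c ≡ d → a ≡ b) → (a ≡ᵇ b) ≡ (c ≡ᵇ d)
≡ᵇ-cong-⇔ a b c d to from with a ≡ᵇ b in a≡ᵇb | c ≡ᵇ d in c≡ᵇd
... | true | true = refl
... | false | false = refl
... | true | false = ⊥-elim (subst T c≡ᵇd (≡⇒≡ᵇ c d (to (≡ᵇ-true⇒≡ a b a≡ᵇb))))
... | false | true = ⊥-elim (subst T a≡ᵇb (≡⇒≡ᵇ a b (from (≡ᵇ-true⇒≡ c d c≡ᵇd))))

≡ᵇ-comm : ∀ a b → (a ≡ᵇ b) ≡ (b ≡ᵇ a)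
≡ᵇ-comm a b = ≡ᵇ-cong-⇔ a b b a sym sym

+-≡ᵇ-cancelˡ : ∀ a m n → (a + m ≡ᵇ a + n) ≡ (m ≡ᵇ n)
+-≡ᵇ-cancelˡ zero m n = refl
+-≡ᵇ-cancelˡ (suc a) m n = +-≡ᵇ-cancelˡ a m n

ι≡ᵇ-*-cong : ∀ a b {x y} → (a ≡ b → x ≡ y) → ι (a ≡ᵇ b) * x ≡ ι (a ≡ᵇ b) * y
ι≡ᵇ-*-cong a b x≡y with a ≡ᵇ b in a≡ᵇb
... | false = refl
... | true = cong (1 *_) (x≡y (≡ᵇ-true⇒≡ a b a≡ᵇb))

countFin-cong : ∀ n {p q : Fin n → Bool} → p ≗ q → countFin n p ≡ countFin n q
countFin-cong zero p≗q = refl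
countFin-cong (suc n) p≗q = cong₂ _+_ (cong ι (p≗q zero)) (countFin-cong n (λ i → p≗q (suc i)))

countFin-not : ∀ n p → countFin n p + countFin n (not ∘ p) ≡ n
countFin-not zero p = refl
countFin-not (suc n) p with p zero
... | true = cong suc (countFin-not n (λ i → p (suc i)))
... | false = trans (+-suc _ _) (cong suc (countFin-not n (λ i → p (suc i))))

allFin-cong : ∀ n {p q : Fin n → Bool} → p ≗ q → allFin n p ≡ allFin n q
allFin-cong zero p≗q = refl
allFin-cong (suc n) p≗q = cong₂ _∧_ (p≗q zero) (allFin-cong n (λ i → p≗q (suc i)))

allFin-true : ∀ n → allFin n (λ _ → true) ≡ true
allFin-true zero = refl
allFin-true (suc n) = allFin-true n

allFin-elim : ∀ n {p : Fin n → Bool} → allFin n p ≡ true → ∀ i → p i ≡ true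
allFin-elim (suc n) all-p zero = proj₁ (∧-true all-p)
allFin-elim (suc n) all-p (suc i) = allFin-elim n (proj₂ (∧-true all-p)) i

m+m≤n+n⇒m≤n : ∀ {m n} → m + m ≤ n + n → m ≤ n
m+m≤n+n⇒m≤n {m} {n} m+m≤n+n with m ℕ.≤? n
... | yes m≤n = m≤n
... | no m≰n = ⊥-elim (<⇒≱ (+-mono-< (≰⇒> m≰n) (≰⇒> m≰n)) m+m≤n+n)

double-injective : ∀ {x k} → x + x ≡ k + k → x ≡ k
double-injective 2x≡2k =
  ≤-antisym (m+m≤n+n⇒m≤n (≤-reflexive 2x≡2k)) (m+m≤n+n⇒m≤n (≤-reflexive (sym 2x≡2k)))

double-≡ᵇ : ∀ x h → (2 * x ≡ᵇ h + h) ≡ (x ≡ᵇ h)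
double-≡ᵇ x h = ≡ᵇ-cong-⇔ (2 * x) (h + h) x h
  (λ 2x≡2h → *-cancelˡ-≡ x h 2 (trans 2x≡2h (cong (h +_) (sym (+-identityʳ h)))))
  (λ x≡h → trans (cong (2 *_) x≡h) (cong (h +_) (+-identityʳ h)))

complement-≡ᵇ : ∀ x x′ h k {n} → x + x′ ≡ n → h + k ≡ n → (x ≡ᵇ h) ≡ true → (x′ ≡ᵇ k) ≡ true
complement-≡ᵇ x x′ h k x+x′≡n h+k≡n x≡ᵇh with ≡ᵇ-true⇒≡ x h x≡ᵇh
... | refl = subst (λ y → (x′ ≡ᵇ y) ≡ true) (+-cancelˡ-≡ x x′ k (trans x+x′≡n (sym h+k≡n)))
  (≡ᵇ-refl x′)

odd-split-below : ∀ x y k → x + y ≡ suc (k + k) → (y ≡ᵇ suc x) ≡ (x ≡ᵇ k)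
odd-split-below x y k x+y≡m = ≡ᵇ-cong-⇔ y (suc x) x k
  (λ { refl → double-injective (suc-injective (trans (sym (+-suc x x)) x+y≡m)) })
  (λ { refl → +-cancelˡ-≡ x y (suc x) (trans x+y≡m (sym (+-suc x x))) })

odd-split-above : ∀ x y k → x + y ≡ suc (k + k) → (x ≡ᵇ suc y) ≡ (x ≡ᵇ suc k)
odd-split-above x y k x+y≡m = ≡ᵇ-cong-⇔ x (suc y) x (suc k)
  (λ { refl → cong suc (double-injective (suc-injective x+y≡m)) })
  (λ { refl → cong suc (sym (+-cancelˡ-≡ k y k (suc-injective x+y≡m))) })

odd+odd-even : ∀ a b → a % 2 ≡ 1 → b % 2 ≡ 1 → (a + b) % 2 ≡ 0
odd+odd-even a b a-odd b-odd = trans (%-distribˡ-+ a b 2) (cong₂ (λ x y → (x + y) % 2) a-odd b-odd)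

odd∸odd-even : ∀ a b → b ≤ a → a % 2 ≡ 1 → b % 2 ≡ 1 → (a ∸ b) % 2 ≡ 0
odd∸odd-even a b b≤a a-odd b-odd with (a ∸ b) % 2 in d-parity | m%n<n (a ∸ b) 2
... | 0 | _ = refl
... | 1 | _ with () ← trans (sym a-odd) (trans (cong (_% 2) (sym (m∸n+n≡m b≤a)))
                       (trans (%-distribˡ-+ (a ∸ b) b 2) (cong₂ (λ x y → (x + y) % 2) d-parity b-odd)))
... | suc (suc _) | s≤s (s≤s ())

[2+n]%2≡n%2 : ∀ n → (2 + n) % 2 ≡ n % 2
[2+n]%2≡n%2 n = trans (cong (_% 2) (+-comm 2 n)) ([m+n]%n≡m%n n 2)

odd⇒pos : ∀ {n} → n % 2 ≡ 1 → 1 ≤ n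
odd⇒pos {suc n} _ = s≤s z≤n

odd-double : ∀ m → m % 2 ≡ 1 → ∃ λ k → m ≡ suc (k + k)
odd-double m m-odd = m / 2 , trans (m≡m%n+[m/n]*n m 2) (cong₂ _+_ m-odd (double (m / 2)))
  where
  double : ∀ x → x * 2 ≡ x + x
  double = solve-∀

even-half : ∀ n → n % 2 ≡ 0 → n / 2 + n / 2 ≡ n
even-half n n-even = sym (trans (m≡m%n+[m/n]*n n 2) (trans (cong (_+ n / 2 * 2) n-even) (double (n / 2))))
  where
  double : ∀ x → 0 + x * 2 ≡ x + x
  double = solve-∀

private variable
  X Y : Set

∑ : List X → (X → ℕ) → ℕ
∑ [] F = 0
∑ (x ∷ xs) F = F x + ∑ xs F

infix 5 ∑
syntax ∑ xs (λ x → F) = ∑[ x ∈ xs ] F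

bools : List Bool
bools = true ∷ false ∷ []

length-filterᵇ : (P : X → Bool) (xs : List X) → length (filterᵇ P xs) ≡ ∑[ x ∈ xs ] ι (P x)
length-filterᵇ P [] = refl
length-filterᵇ P (x ∷ xs) with P x
... | true = cong suc (length-filterᵇ P xs)
... | false = length-filterᵇ P xs

∑-cong : (xs : List X) {F G : X → ℕ} → (∀ x → F x ≡ G x) → ∑ xs F ≡ ∑ xs G
∑-cong [] F≗G = refl
∑-cong (x ∷ xs) F≗G = cong₂ _+_ (F≗G x) (∑-cong xs F≗G)

∑-zero : (xs : List X) {F : X → ℕ} → (∀ x → F x ≡ 0) → ∑ xs F ≡ 0
∑-zero [] F≗0 = refl
∑-zero (x ∷ xs) F≗0 = cong₂ _+_ (F≗0 x) (∑-zero xs F≗0)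

∑-mono : (xs : List X) {F G : X → ℕ} → (∀ x → F x ≤ G x) → ∑ xs F ≤ ∑ xs G
∑-mono [] F≤G = z≤n
∑-mono (x ∷ xs) F≤G = +-mono-≤ (F≤G x) (∑-mono xs F≤G)

∑-++ : (xs ys : List X) (F : X → ℕ) → ∑ (xs ++ ys) F ≡ ∑ xs F + ∑ ys F
∑-++ [] ys F = refl
∑-++ (x ∷ xs) ys F = trans (cong (F x +_) (∑-++ xs ys F)) (sym (+-assoc (F x) _ _))

∑-+ : (xs : List X) (F G : X → ℕ) → ∑[ x ∈ xs ] (F x + G x) ≡ ∑ xs F + ∑ xs G
∑-+ [] F G = refl
∑-+ (x ∷ xs) F G = trans (cong (F x + G x +_) (∑-+ xs F G)) (+-interchange (F x) (G x) _ _)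
  where
  +-interchange : ∀ a b c d → a + b + (c + d) ≡ a + c + (b + d)
  +-interchange = solve-∀

∑-*ˡ : (xs : List X) (c : ℕ) (F : X → ℕ) → ∑[ x ∈ xs ] (c * F x) ≡ c * ∑ xs F
∑-*ˡ [] c F = sym (*-zeroʳ c)
∑-*ˡ (x ∷ xs) c F = trans (cong (c * F x +_) (∑-*ˡ xs c F)) (sym (*-distribˡ-+ c (F x) _))

∑-*ʳ : (xs : List X) (c : ℕ) (F : X → ℕ) → ∑[ x ∈ xs ] (F x * c) ≡ ∑ xs F * c
∑-*ʳ [] c F = refl
∑-*ʳ (x ∷ xs) c F = trans (cong (F x * c +_) (∑-*ʳ xs c F)) (sym (*-distribʳ-+ c (F x) _))

∑-comm : (xs : List X) (ys : List Y) (F : X → Y → ℕ) →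
  ∑[ x ∈ xs ] ∑[ y ∈ ys ] F x y ≡ ∑[ y ∈ ys ] ∑[ x ∈ xs ] F x y
∑-comm [] ys F = sym (∑-zero ys λ _ → refl)
∑-comm (x ∷ xs) ys F =
  trans (cong (∑ ys (F x) +_) (∑-comm xs ys F)) (sym (∑-+ ys (F x) λ y → ∑[ x′ ∈ xs ] F x′ y))

∑-concatMap : (f : X → List Y) (xs : List X) (F : Y → ℕ) →
  ∑ (concatMap f xs) F ≡ ∑[ x ∈ xs ] ∑ (f x) F
∑-concatMap f [] F = refl
∑-concatMap f (x ∷ xs) F =
  trans (∑-++ (f x) (concatMap f xs) F) (cong (∑ (f x) F +_) (∑-concatMap f xs F))

∑-map : (f : X → Y) (xs : List X) (F : Y → ℕ) → ∑ (map f xs) F ≡ ∑[ x ∈ xs ] F (f x)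
∑-map f [] F = refl
∑-map f (x ∷ xs) F = cong (F (f x) +_) (∑-map f xs F)

∑-bools : (F : Bool → ℕ) → ∑ bools F ≡ F true + F false
∑-bools F = cong (F true +_) (+-identityʳ (F false))

∑-bools-at : (b : Bool) (F : Bool → ℕ) → F (not b) ≡ 0 → ∑ bools F ≡ F b
∑-bools-at true F F-false = trans (∑-bools F) (trans (cong (F true +_) F-false) (+-identityʳ _))
∑-bools-at false F F-true = trans (∑-bools F) (cong (_+ F false) F-true)

∑-if : (b : Bool) (xs : List X) (F : X → ℕ) →
  ∑[ x ∈ xs ] (if b then F x else 0) ≡ (if b then ∑ xs F else 0)
∑-if true xs F = refl
∑-if false xs F = ∑-zero xs λ _ → refl

_≗₂_ : {A B C : Set} → (A → B → C) → (A → B → C) → Set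
R ≗₂ R′ = ∀ x y → R x y ≡ R′ x y

∑-allFns-suc : (n : ℕ) (xs : List X) (F : (Fin (suc n) → X) → ℕ) →
  ∑ (allFns (suc n) xs) F ≡ ∑[ x ∈ xs ] ∑[ g ∈ allFns n xs ] F (x ∷ᶠ g)
∑-allFns-suc n xs F =
  trans (∑-concatMap (λ x → map (x ∷ᶠ_) (allFns n xs)) xs F)
        (∑-cong xs λ x → ∑-map (x ∷ᶠ_) (allFns n xs) F)

∑-allFns-columns : (k n : ℕ) (xs : List X) (F : (Fin n → Fin (suc k) → X) → ℕ) →
  (∀ R R′ → R ≗₂ R′ → F R ≡ F R′) →
  ∑ (allFns n (allFns (suc k) xs)) F ≡
  ∑[ c ∈ allFns n xs ] ∑[ R ∈ allFns n (allFns k xs) ] F (λ v → c v ∷ᶠ R v)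
∑-allFns-columns k zero xs F F-cong = cong (_+ 0) (trans (F-cong _ _ λ ()) (sym (+-identityʳ _)))
∑-allFns-columns {X} k (suc n) xs F F-cong = begin
  ∑ (allFns (suc n) rows) F
    ≡⟨ ∑-allFns-suc n rows F ⟩
  ∑[ r ∈ rows ] ∑[ R ∈ allFns n rows ] F (r ∷ᶠ R)
    ≡⟨ ∑-cong rows (λ r → ∑-allFns-columns k n xs (λ R → F (r ∷ᶠ R))
         λ R R′ R≗R′ → F-cong _ _ λ { zero w → refl ; (suc v) w → R≗R′ v w }) ⟩
  ∑[ r ∈ rows ] ∑[ c ∈ allFns n xs ] ∑[ R ∈ allFns n tails ] F (r ∷ᶠ λ v → c v ∷ᶠ R v)
    ≡⟨ ∑-allFns-suc k xs _ ⟩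
  ∑[ x ∈ xs ] ∑[ t ∈ tails ] ∑[ c ∈ allFns n xs ] ∑[ R ∈ allFns n tails ]
    F ((x ∷ᶠ t) ∷ᶠ λ v → c v ∷ᶠ R v)
    ≡⟨ ∑-cong xs (λ x → ∑-comm tails (allFns n xs) _) ⟩
  ∑[ x ∈ xs ] ∑[ c ∈ allFns n xs ] ∑[ t ∈ tails ] ∑[ R ∈ allFns n tails ]
    F ((x ∷ᶠ t) ∷ᶠ λ v → c v ∷ᶠ R v)
    ≡⟨ ∑-cong xs (λ x → ∑-cong (allFns n xs) λ c → sym (trans (∑-allFns-suc n tails _)
         (∑-cong tails λ t → ∑-cong (allFns n tails) λ R →
           F-cong _ _ λ { zero w → refl ; (suc v) w → refl }))) ⟩
  ∑[ x ∈ xs ] ∑[ c ∈ allFns n xs ] ∑[ R ∈ allFns (suc n) tails ]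
    F (λ v → (x ∷ᶠ c) v ∷ᶠ R v)
    ≡⟨ sym (∑-allFns-suc n xs _) ⟩
  ∑[ c ∈ allFns (suc n) xs ] ∑[ R ∈ allFns (suc n) tails ] F (λ v → c v ∷ᶠ R v) ∎
  where
  open ≡-Reasoning
  rows : List (Fin (suc k) → X)
  rows = allFns (suc k) xs
  tails : List (Fin k → X)
  tails = allFns k xs

∑-forced : (n : ℕ) (F : (Fin n → Bool) → ℕ) (h : Fin n → Bool) →
  (∀ c c′ → c ≗ c′ → F c ≡ F c′) → (∀ c v → h v ≢ c v → F c ≡ 0) →
  ∑[ c ∈ allFns n bools ] F c ≡ F h
∑-forced zero F h F-cong vanish = trans (+-identityʳ _) (F-cong _ _ λ ())
∑-forced (suc n) F h F-cong vanish = begin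
  ∑[ c ∈ allFns (suc n) bools ] F c
    ≡⟨ ∑-allFns-suc n bools F ⟩
  ∑[ x ∈ bools ] ∑[ c ∈ allFns n bools ] F (x ∷ᶠ c)
    ≡⟨ ∑-bools-at (h zero) (λ x → ∑[ c ∈ allFns n bools ] F (x ∷ᶠ c))
         (∑-zero (allFns n bools) λ c → vanish _ zero (not-¬ refl)) ⟩
  ∑[ c ∈ allFns n bools ] F (h zero ∷ᶠ c)
    ≡⟨ ∑-forced n (λ c → F (h zero ∷ᶠ c)) (λ v → h (suc v))
         (λ c c′ c≗c′ → F-cong _ _ λ { zero → refl ; (suc v) → c≗c′ v })
         (λ c v hv≢cv → vanish _ (suc v) hv≢cv) ⟩
  F (h zero ∷ᶠ λ v → h (suc v))
    ≡⟨ F-cong _ _ (λ { zero → refl ; (suc v) → refl }) ⟩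
  F h ∎
  where open ≡-Reasoning

-- Binomial coefficients

binom : ℕ → ℕ → ℕ
binom n zero = 1
binom zero (suc k) = 0
binom (suc n) (suc k) = binom n k + binom n (suc k)

binom≡C : ∀ n k → binom n k ≡ n C k
binom≡C n zero = refl
binom≡C zero (suc k) = sym (k>n⇒nCk≡0 {0} {suc k} (s≤s z≤n))
binom≡C (suc n) (suc k) =
  trans (cong₂ _+_ (binom≡C n k) (binom≡C n (suc k))) (nCk+nC[k+1]≡[n+1]C[k+1] n k)

binom-> : ∀ n k → n < k → binom n k ≡ 0
binom-> zero (suc k) n<k = refl
binom-> (suc n) (suc k) (s≤s n<k) = cong₂ _+_ (binom-> n k n<k) (binom-> n (suc k) (m≤n⇒m≤1+n n<k))

binom-pos : ∀ n k → k ≤ n → 0 < binom n k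
binom-pos n zero k≤n = s≤s z≤n
binom-pos (suc n) (suc k) (s≤s k≤n) = <-≤-trans (binom-pos n k k≤n) (m≤m+n _ _)

binom-sym : ∀ n k → k ≤ n → binom n k ≡ binom n (n ∸ k)
binom-sym n k k≤n = trans (binom≡C n k) (trans (nCk≡nC[n∸k] k≤n) (sym (binom≡C n (n ∸ k))))

binom-sym′ : ∀ n j k → j + k ≡ n → binom n j ≡ binom n k
binom-sym′ n j k refl = trans (binom-sym (j + k) j (m≤m+n j k)) (cong (binom (j + k)) (m+n∸m≡n j k))

binom-absorption : ∀ n k → suc k * binom (suc n) (suc k) ≡ suc n * binom n k
binom-absorption zero zero = refl
binom-absorption zero (suc k) = *-zeroʳ (suc (suc k))
binom-absorption (suc n) zero = begin
  1 * (1 + binom (suc n) 1)  ≡⟨ *-identityˡ _ ⟩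
  1 + binom (suc n) 1        ≡⟨ cong suc (trans (sym (*-identityˡ _)) (binom-absorption n 0)) ⟩
  1 + suc n * 1              ≡⟨ solve (n ∷ []) ⟩
  suc (suc n) * 1            ∎
  where open ≡-Reasoning
binom-absorption (suc n) (suc k) = begin
  suc (suc k) * (x + y)                    ≡⟨ split k x y ⟩
  x + suc k * x + suc (suc k) * y
    ≡⟨ cong₂ (λ u v → x + u + v) (binom-absorption n k) (binom-absorption n (suc k)) ⟩
  x + suc n * binom n k + suc n * binom n (suc k) ≡⟨ merge n (binom n k) (binom n (suc k)) ⟩
  suc (suc n) * (binom n k + binom n (suc k)) ∎
  where
  open ≡-Reasoning
  x y : ℕ
  x = binom (suc n) (suc k)
  y = binom (suc n) (suc (suc k))
  split : ∀ k x y → suc (suc k) * (x + y) ≡ x + suc k * x + suc (suc k) * y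
  split = solve-∀
  merge : ∀ n a b → a + b + suc n * a + suc n * b ≡ suc (suc n) * (a + b)
  merge = solve-∀

binom-absorption′ : ∀ n k → suc k * binom n (suc k) + suc k * binom n k ≡ suc n * binom n k
binom-absorption′ n k = begin
  suc k * binom n (suc k) + suc k * binom n k ≡⟨ +-comm (suc k * binom n (suc k)) _ ⟩
  suc k * binom n k + suc k * binom n (suc k) ≡⟨ *-distribˡ-+ (suc k) (binom n k) (binom n (suc k)) ⟨
  suc k * (binom n k + binom n (suc k))       ≡⟨ binom-absorption n k ⟩
  suc n * binom n k                           ∎
  where open ≡-Reasoning

-- Absorption turns the two ratios into (z − j)/(j + 1) and (N − p − j)/(p + j + 1), where N = z + 2p;
-- comparing them comes down to p (z − j) ≤ p (j + 1).
binom-ratio : ∀ z p j → suc z ≤ j + j →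
  binom z (suc j) * binom (z + p + p) (p + j) ≤ binom z j * binom (z + p + p) (suc (p + j))
binom-ratio z p j z<2j = *-cancelˡ-≤ K (+-cancelʳ-≤ (K * (x * y)) (K * (x′ * y)) (K * (x * y′)) (begin
  K * (x′ * y) + K * (x * y)                       ≡⟨ regroupˡ j p x x′ y ⟩
  suc (p + j) * y * (suc j * x′ + suc j * x)       ≡⟨ cong (suc (p + j) * y *_) (binom-absorption′ z j) ⟩
  suc (p + j) * y * (suc z * x)                    ≡⟨ regroup (p + j) z y x ⟩
  suc (p + j) * suc z * (y * x)                    ≡⟨ cong (suc (p + j) * suc z *_) (*-comm y x) ⟩
  suc (p + j) * suc z * (x * y)                    ≤⟨ *-monoˡ-≤ (x * y) coefficients ⟩
  suc j * suc N * (x * y)                          ≡⟨ regroup j N x y ⟨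
  suc j * x * (suc N * y)                          ≡⟨ cong (suc j * x *_) (binom-absorption′ N (p + j)) ⟨
  suc j * x * (suc (p + j) * y′ + suc (p + j) * y) ≡⟨ regroupʳ j p x y y′ ⟩
  K * (x * y′) + K * (x * y)                       ∎))
  where
  open ≤-Reasoning
  N x x′ y y′ K : ℕ
  N = z + p + p
  x = binom z j
  x′ = binom z (suc j)
  y = binom N (p + j)
  y′ = binom N (suc (p + j))
  K = suc j * suc (p + j)
  regroupˡ : ∀ j p x x′ y → suc j * suc (p + j) * (x′ * y) + suc j * suc (p + j) * (x * y)
                          ≡ suc (p + j) * y * (suc j * x′ + suc j * x)
  regroupˡ = solve-∀
  regroupʳ : ∀ j p x y y′ → suc j * x * (suc (p + j) * y′ + suc (p + j) * y)
                          ≡ suc j * suc (p + j) * (x * y′) + suc j * suc (p + j) * (x * y)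
  regroupʳ = solve-∀
  regroup : ∀ c d u v → suc c * u * (suc d * v) ≡ suc c * suc d * (u * v)
  regroup = solve-∀
  coefficients : suc (p + j) * suc z ≤ suc j * suc N
  coefficients = begin
    suc (p + j) * suc z                  ≡⟨ solve (p ∷ j ∷ z ∷ []) ⟩
    p * suc z + suc j * suc z            ≤⟨ +-monoˡ-≤ _ (*-monoʳ-≤ p z<2j) ⟩
    p * (j + j) + suc j * suc z          ≤⟨ +-monoˡ-≤ _ (*-monoʳ-≤ p (+-mono-≤ (n≤1+n j) (n≤1+n j))) ⟩
    p * (suc j + suc j) + suc j * suc z  ≡⟨ collect p j z ⟩
    suc j * suc N                        ∎
    where
    collect : ∀ p j z → p * (suc j + suc j) + suc j * suc z ≡ suc j * suc (z + p + p)
    collect = solve-∀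

shiftedBinom : ℕ → ℕ → ℕ → ℕ
shiftedBinom z zero A = binom z A
shiftedBinom z (suc p) zero = 0
shiftedBinom z (suc p) (suc A) = shiftedBinom z p A

shiftedBinom-< : ∀ z p A → A < p → shiftedBinom z p A ≡ 0
shiftedBinom-< z (suc p) zero A<p = refl
shiftedBinom-< z (suc p) (suc A) (s≤s A<p) = shiftedBinom-< z p A A<p

shiftedBinom-+ : ∀ z p j → shiftedBinom z p (p + j) ≡ binom z j
shiftedBinom-+ z zero j = refl
shiftedBinom-+ z (suc p) j = shiftedBinom-+ z p j

shiftedBinom-suc-≤ : ∀ z p A → A ≤ p → shiftedBinom z p A ≡ shiftedBinom (suc z) p A
shiftedBinom-suc-≤ z zero zero A≤p = refl
shiftedBinom-suc-≤ z (suc p) zero A≤p = refl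
shiftedBinom-suc-≤ z (suc p) (suc A) (s≤s A≤p) = shiftedBinom-suc-≤ z p A A≤p

shiftedBinom-pascal : ∀ z p A → shiftedBinom z p A + shiftedBinom z p (suc A) ≡ shiftedBinom (suc z) p (suc A)
shiftedBinom-pascal z zero A = refl
shiftedBinom-pascal z (suc p) zero = shiftedBinom-suc-≤ z p zero z≤n
shiftedBinom-pascal z (suc p) (suc A) = shiftedBinom-pascal z p A

shiftedBinom-large : ∀ z p B → z + p < B → shiftedBinom z p B ≡ 0
shiftedBinom-large z zero B z<B = binom-> z B (subst (_< B) (+-identityʳ z) z<B)
shiftedBinom-large z (suc p) (suc B) z+p<B =
  shiftedBinom-large z p B (s≤s⁻¹ (subst (_< suc B) (+-suc z p) z+p<B))

shiftedBinom-sym : ∀ z p A B → A + B ≡ z + p + p → shiftedBinom z p A ≡ shiftedBinom z p B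
shiftedBinom-sym z zero A B A+B≡z = binom-sym′ z A B (trans A+B≡z (trans (+-identityʳ _) (+-identityʳ z)))
shiftedBinom-sym z (suc p) zero B B≡N =
  sym (shiftedBinom-large z (suc p) B (subst (z + suc p <_) (sym B≡N) (m<m+n (z + suc p) z<s)))
shiftedBinom-sym z (suc p) (suc A) zero A≡N =
  shiftedBinom-large z (suc p) (suc A) (subst (z + suc p <_) (sym (trans (sym (+-identityʳ _)) A≡N)) (m<m+n (z + suc p) z<s))
shiftedBinom-sym z (suc p) (suc A) (suc B) A+B≡N = shiftedBinom-sym z p A B
  (suc-injective (suc-injective (trans (cong suc (sym (+-suc A B))) (trans A+B≡N (peel z p)))))
  where
  peel : ∀ z p → z + suc p + suc p ≡ suc (suc (z + p + p))
  peel = solve-∀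

shiftedBinom-ratio : ∀ z p h → suc (z + p + p) ≤ h + h →
  shiftedBinom z p (suc h) * binom (z + p + p) h ≤ shiftedBinom z p h * binom (z + p + p) (suc h)
shiftedBinom-ratio z p h N<2h with m≤n⇒∃[o]m+o≡n p≤h
  where
  p≤h : p ≤ h
  p≤h = m+m≤n+n⇒m≤n (≤-trans (+-monoˡ-≤ p (m≤n+m p z)) (<⇒≤ N<2h))
... | j , refl = subst₂ _≤_
  (cong (_* binom N (p + j)) (sym (trans (cong (shiftedBinom z p) (sym (+-suc p j))) (shiftedBinom-+ z p (suc j)))))
  (cong (_* binom N (suc (p + j))) (sym (shiftedBinom-+ z p j)))
  (binom-ratio z p j z<2j)
  where
  N : ℕ
  N = z + p + p
  z<2j : suc z ≤ j + j
  z<2j = +-cancelʳ-≤ (p + p) (suc z) (j + j) (subst₂ _≤_ (reorderˡ z p) (reorderʳ p j) N<2h)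
    where
    reorderˡ : ∀ z p → suc (z + p + p) ≡ suc z + (p + p)
    reorderˡ = solve-∀
    reorderʳ : ∀ p j → p + j + (p + j) ≡ j + j + (p + p)
    reorderʳ = solve-∀

ratio-chain : (x c : ℕ → ℕ) (h₀ M : ℕ) →
  (∀ h → h₀ ≤ h → h < M → x (suc h) * c h ≤ x h * c (suc h)) → (∀ h → h ≤ M → 0 < c h) →
  ∀ {h} → h₀ ≤′ h → h ≤ M → x h * c h₀ ≤ x h₀ * c h
ratio-chain x c h₀ M step pos ℕ.≤′-refl _ = ≤-refl
ratio-chain x c h₀ M step pos (ℕ.≤′-step {h} h₀≤′h) h<M =
  *-cancelˡ-≤ (c h) {{ℕ.>-nonZero (pos h (<⇒≤ h<M))}} (begin
  c h * (x (suc h) * c h₀)   ≡⟨ swap₁ (c h) (x (suc h)) (c h₀) ⟩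
  x (suc h) * c h * c h₀     ≤⟨ *-monoˡ-≤ (c h₀) (step h (≤′⇒≤ h₀≤′h) h<M) ⟩
  x h * c (suc h) * c h₀     ≡⟨ swap₂ (x h) (c (suc h)) (c h₀) ⟩
  x h * c h₀ * c (suc h)     ≤⟨ *-monoˡ-≤ (c (suc h)) (ratio-chain x c h₀ M step pos h₀≤′h (<⇒≤ h<M)) ⟩
  x h₀ * c h * c (suc h)     ≡⟨ swap₃ (x h₀) (c h) (c (suc h)) ⟩
  c h * (x h₀ * c (suc h))   ∎)
  where
  open ≤-Reasoning
  swap₁ : ∀ a b e → a * (b * e) ≡ b * a * e
  swap₁ = solve-∀
  swap₂ : ∀ a b e → a * b * e ≡ a * e * b
  swap₂ = solve-∀
  swap₃ : ∀ a b e → a * b * e ≡ b * (a * e)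
  swap₃ = solve-∀

-- Attaching s and t to a tournament on V

-- x and y say whether s → v and t → v; the arcs v → s and v → t are then not x and not y,
-- and o, i are the out- and in-degree of v inside V.
balancedAt : Bool → Bool → ℕ → ℕ → Bool
balancedAt x y o i = (ι (not x) + (ι (not y) + o)) ≡ᵇ (ι x + (ι y + i))

balanced : (m : ℕ) (o i : Fin m → ℕ) (s⁺ t⁺ : Fin m → Bool) → Bool
balanced m o i s⁺ t⁺ = allFin m (λ v → balancedAt (s⁺ v) (t⁺ v) (o v) (i v))

attachments : (m : ℕ) (o i : Fin m → ℕ) → ℕ → ℕ → ℕ
attachments m o i A B = ∑[ s⁺ ∈ allFns m bools ] ∑[ t⁺ ∈ allFns m bools ]
  ι (balanced m o i s⁺ t⁺ ∧ ((countFin m s⁺ ≡ᵇ A) ∧ (countFin m (not ∘ t⁺) ≡ᵇ B)))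

data Kind : Set where
  surplus deficit level defective : Kind

kind : ℕ → ℕ → Kind
kind (suc o) (suc i) = kind o i
kind zero zero = level
kind (suc (suc zero)) zero = surplus
kind zero (suc (suc zero)) = deficit
kind _ _ = defective

allowed : Kind → Bool → Bool → Bool
allowed surplus x y = x ∧ y
allowed deficit x y = not x ∧ not y
allowed level x y = x xor y
allowed defective x y = false

balancedAt≡allowed : ∀ o i x y → balancedAt x y o i ≡ allowed (kind o i) x y
balancedAt≡allowed (suc o) (suc i) x y =
  trans (pointwise {λ x y → balancedAt x y (suc o) (suc i)} {λ x y → balancedAt x y o i} refl refl refl refl x y)
        (balancedAt≡allowed o i x y)
balancedAt≡allowed zero zero = pointwise refl refl refl refl
balancedAt≡allowed zero (suc zero) = pointwise refl refl refl refl
balancedAt≡allowed zero (suc (suc zero)) = pointwise refl refl refl refl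
balancedAt≡allowed zero (suc (suc (suc i))) = pointwise refl refl refl refl
balancedAt≡allowed (suc zero) zero = pointwise refl refl refl refl
balancedAt≡allowed (suc (suc zero)) zero = pointwise refl refl refl refl
balancedAt≡allowed (suc (suc (suc o))) zero = pointwise refl refl refl refl

record Census : Set where
  constructor census
  field
    consistent : Bool
    levels surpluses deficits : ℕ

open Census

tally : Kind → Census → Census
tally surplus (census ok z p q) = census ok z (suc p) q
tally deficit (census ok z p q) = census ok z p (suc q)
tally level (census ok z p q) = census ok (suc z) p q
tally defective (census ok z p q) = census false z p q

censusOf : (m : ℕ) (o i : Fin m → ℕ) → Census
censusOf zero o i = census true 0 0 0
censusOf (suc m) o i = tally (kind (o zero) (i zero)) (censusOf m (λ v → o (suc v)) (λ v → i (suc v)))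

size : Census → ℕ
size c = levels c + surpluses c + deficits c

tally-size : ∀ κ c → consistent (tally κ c) ≡ true → consistent c ≡ true × size (tally κ c) ≡ suc (size c)
tally-size surplus (census ok z p q) ok≡true = ok≡true , cong (_+ q) (+-suc z p)
tally-size deficit (census ok z p q) ok≡true = ok≡true , +-suc (z + p) q
tally-size level (census ok z p q) ok≡true = ok≡true , refl
tally-size defective (census ok z p q) ()

censusOf-size : ∀ m o i → consistent (censusOf m o i) ≡ true → size (censusOf m o i) ≡ m
censusOf-size zero o i _ = refl
censusOf-size (suc m) o i consistent =
  let c-consistent , size-suc = tally-size (kind (o zero) (i zero)) (censusOf m o′ i′) consistent
  in trans size-suc (cong suc (censusOf-size m o′ i′ c-consistent))
  where
  o′ i′ : Fin m → ℕ
  o′ v = o (suc v)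
  i′ v = i (suc v)

-- Each surplus vertex has s → v and t → v, each deficit vertex v → s and v → t, and a level
-- vertex exactly one of s → v, t → v; so d⁺(s) = p + k and d⁻(t) = q + k where k counts the
-- level vertices with s → v.
ways : Census → ℕ → ℕ → ℕ
ways (census ok z p q) A B = ι ok * (ι (A + q ≡ᵇ B + p) * shiftedBinom z p A)

shift : Bool → ℕ → (ℕ → ℕ) → ℕ
shift false A k = k A
shift true zero k = 0
shift true (suc A) k = k A

shift-cong : ∀ b A {k k′ : ℕ → ℕ} → (∀ n → k n ≡ k′ n) → shift b A k ≡ shift b A k′
shift-cong false A k≗k′ = k≗k′ A
shift-cong true zero k≗k′ = refl
shift-cong true (suc A) k≗k′ = k≗k′ A

∑-shift : (b : Bool) (A : ℕ) (xs : List X) (k : X → ℕ → ℕ) →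
  ∑[ x ∈ xs ] shift b A (k x) ≡ shift b A (λ A′ → ∑[ x ∈ xs ] k x A′)
∑-shift false A xs k = refl
∑-shift true zero xs k = ∑-zero xs λ _ → refl
∑-shift true (suc A) xs k = refl

ι-shift : ∀ P x w a b A B → ι (P ∧ ((ι x + a ≡ᵇ A) ∧ (ι w + b ≡ᵇ B))) ≡
  shift x A (λ A′ → shift w B (λ B′ → ι (P ∧ ((a ≡ᵇ A′) ∧ (b ≡ᵇ B′)))))
ι-shift P true w a b zero B = cong ι (∧-zeroʳ P)
ι-shift P false true a b A zero = cong ι (trans (cong (P ∧_) (∧-zeroʳ (a ≡ᵇ A))) (∧-zeroʳ P))
ι-shift P true true a b (suc A) zero = cong ι (trans (cong (P ∧_) (∧-zeroʳ (a ≡ᵇ A))) (∧-zeroʳ P))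
ι-shift P false false a b A B = refl
ι-shift P true false a b (suc A) B = refl
ι-shift P false true a b A (suc B) = refl
ι-shift P true true a b (suc A) (suc B) = refl

-- One more vertex, of kind κ: it adds x to d⁺(s) and not y to d⁻(t).
extend : (ℕ → ℕ → ℕ) → Kind → ℕ → ℕ → ℕ
extend K κ A B = ∑[ x ∈ bools ] ∑[ y ∈ bools ]
  (if allowed κ x y then shift x A (λ A′ → shift (not y) B (K A′)) else 0)

extend-cong : ∀ κ A B {K K′ : ℕ → ℕ → ℕ} → (∀ A B → K A B ≡ K′ A B) →
  extend K κ A B ≡ extend K′ κ A B
extend-cong κ A B K≗K′ = ∑-cong bools λ x → ∑-cong bools λ y →
  cong (λ n → if allowed κ x y then n else 0) (shift-cong x A λ A′ → shift-cong (not y) B (K≗K′ A′))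

extend-ways : ∀ κ c A B → extend (ways c) κ A B ≡ ways (tally κ c) A B
extend-ways surplus (census ok z p q) zero B =
  sym (trans (cong (ι ok *_) (*-zeroʳ (ι (q ≡ᵇ B + suc p)))) (*-zeroʳ (ι ok)))
extend-ways surplus (census ok z p q) (suc A) B = trans (+-identityʳ _) (trans (+-identityʳ _)
  (cong (λ n → ι ok * (ι (suc (A + q) ≡ᵇ n) * shiftedBinom z p A)) (sym (+-suc B p))))
extend-ways deficit (census ok z p q) A zero = sym (begin
  ι ok * (ι (A + suc q ≡ᵇ p) * shiftedBinom z p A) ≡⟨ cong (ι ok *_) (ι≡ᵇ-*-cong (A + suc q) p A<p) ⟩
  ι ok * (ι (A + suc q ≡ᵇ p) * 0)                  ≡⟨ cong (ι ok *_) (*-zeroʳ (ι (A + suc q ≡ᵇ p))) ⟩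
  ι ok * 0                                         ≡⟨ *-zeroʳ (ι ok) ⟩
  0                                                ∎)
  where
  open ≡-Reasoning
  A<p : A + suc q ≡ p → shiftedBinom z p A ≡ 0
  A<p refl = shiftedBinom-< z _ A (≤-trans (s≤s (m≤m+n A q)) (≤-reflexive (sym (+-suc A q))))
extend-ways deficit (census ok z p q) A (suc B) = trans (+-identityʳ _) (trans (+-identityʳ _)
  (cong (λ n → ι ok * (ι (n ≡ᵇ suc (B + p)) * shiftedBinom z p A)) (sym (+-suc A q))))
extend-ways level (census ok z p q) zero B = trans (+-identityʳ _) (trans (+-identityʳ _)
  (cong (λ n → ι ok * (ι (q ≡ᵇ B + p) * n)) (shiftedBinom-suc-≤ z p 0 z≤n)))
extend-ways level (census ok z p q) (suc A) zero = trans (+-identityʳ _) (trans (+-identityʳ _)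
  (cong (ι ok *_) (ι≡ᵇ-*-cong (suc (A + q)) p A<p)))
  where
  A<p : suc (A + q) ≡ p → shiftedBinom z p (suc A) ≡ shiftedBinom (suc z) p (suc A)
  A<p refl = shiftedBinom-suc-≤ z _ (suc A) (s≤s (m≤m+n A q))
extend-ways level (census ok z p q) (suc A) (suc B) = begin
  (ι ok * (c * shiftedBinom z p A) + 0) + ((ι ok * (c * shiftedBinom z p (suc A)) + 0) + 0)
    ≡⟨ cong₂ _+_ (+-identityʳ (ι ok * (c * shiftedBinom z p A)))
                 (trans (+-identityʳ _) (+-identityʳ (ι ok * (c * shiftedBinom z p (suc A))))) ⟩
  ι ok * (c * shiftedBinom z p A) + ι ok * (c * shiftedBinom z p (suc A))
    ≡⟨ distrib (ι ok) c (shiftedBinom z p A) (shiftedBinom z p (suc A)) ⟩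
  ι ok * (c * (shiftedBinom z p A + shiftedBinom z p (suc A)))
    ≡⟨ cong (λ n → ι ok * (c * n)) (shiftedBinom-pascal z p A) ⟩
  ι ok * (c * shiftedBinom (suc z) p (suc A)) ∎
  where
  open ≡-Reasoning
  c : ℕ
  c = ι (A + q ≡ᵇ B + p)
  distrib : ∀ u c x y → u * (c * x) + u * (c * y) ≡ u * (c * (x + y))
  distrib = solve-∀
extend-ways defective (census ok z p q) A B = refl

attachments-shift : ∀ m o i x w A B →
  ∑[ s⁺ ∈ allFns m bools ] ∑[ t⁺ ∈ allFns m bools ] ι (balanced m o i s⁺ t⁺ ∧
    ((ι x + countFin m s⁺ ≡ᵇ A) ∧ (ι w + countFin m (not ∘ t⁺) ≡ᵇ B)))
  ≡ shift x A (λ A′ → shift w B (attachments m o i A′))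
attachments-shift m o i x w A B = begin
  ∑[ s⁺ ∈ allFns m bools ] ∑[ t⁺ ∈ allFns m bools ] ι (balanced m o i s⁺ t⁺ ∧
    ((ι x + countFin m s⁺ ≡ᵇ A) ∧ (ι w + countFin m (not ∘ t⁺) ≡ᵇ B)))
    ≡⟨ ∑-cong (allFns m bools) (λ s⁺ → ∑-cong (allFns m bools) λ t⁺ →
         ι-shift (balanced m o i s⁺ t⁺) x w (countFin m s⁺) _ A B) ⟩
  ∑[ s⁺ ∈ allFns m bools ] ∑[ t⁺ ∈ allFns m bools ] shift x A (λ A′ → shift w B (term s⁺ t⁺ A′))
    ≡⟨ ∑-cong (allFns m bools) (λ s⁺ → ∑-shift x A (allFns m bools) λ t⁺ A′ → shift w B (term s⁺ t⁺ A′)) ⟩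
  ∑[ s⁺ ∈ allFns m bools ] shift x A (λ A′ → ∑[ t⁺ ∈ allFns m bools ] shift w B (term s⁺ t⁺ A′))
    ≡⟨ ∑-shift x A (allFns m bools) _ ⟩
  shift x A (λ A′ → ∑[ s⁺ ∈ allFns m bools ] ∑[ t⁺ ∈ allFns m bools ] shift w B (term s⁺ t⁺ A′))
    ≡⟨ shift-cong x A (λ A′ → trans (∑-cong (allFns m bools) λ s⁺ → ∑-shift w B (allFns m bools) λ t⁺ → term s⁺ t⁺ A′)
                                     (∑-shift w B (allFns m bools) _)) ⟩
  shift x A (λ A′ → shift w B (attachments m o i A′)) ∎
  where
  open ≡-Reasoning
  term : (s⁺ t⁺ : Fin m → Bool) → ℕ → ℕ → ℕ
  term s⁺ t⁺ A′ B′ = ι (balanced m o i s⁺ t⁺ ∧ ((countFin m s⁺ ≡ᵇ A′) ∧ (countFin m (not ∘ t⁺) ≡ᵇ B′)))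

attachments-suc : ∀ m o i A B → attachments (suc m) o i A B ≡
  extend (attachments m (λ v → o (suc v)) (λ v → i (suc v))) (kind (o zero) (i zero)) A B
attachments-suc m o i A B = begin
  attachments (suc m) o i A B
    ≡⟨ ∑-allFns-suc m bools _ ⟩
  ∑[ x ∈ bools ] ∑[ s⁺ ∈ fns ] ∑[ t⁺ ∈ allFns (suc m) bools ] ι (balanced (suc m) o i (x ∷ᶠ s⁺) t⁺ ∧ degrees x s⁺ t⁺)
    ≡⟨ ∑-cong bools (λ x → ∑-cong fns λ s⁺ → trans
         (∑-allFns-suc m bools λ t⁺ → ι (balanced (suc m) o i (x ∷ᶠ s⁺) t⁺ ∧ degrees x s⁺ t⁺))
         (∑-cong bools λ y → ∑-cong fns λ t⁺ → ι-∧-assoc (local x y) (balanced m o′ i′ s⁺ t⁺) (degrees′ x y s⁺ t⁺))) ⟩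
  ∑[ x ∈ bools ] ∑[ s⁺ ∈ fns ] ∑[ y ∈ bools ] ∑[ t⁺ ∈ fns ] (if local x y then term x y s⁺ t⁺ else 0)
    ≡⟨ ∑-cong bools (λ x → ∑-comm fns bools λ s⁺ y → ∑[ t⁺ ∈ fns ] (if local x y then term x y s⁺ t⁺ else 0)) ⟩
  ∑[ x ∈ bools ] ∑[ y ∈ bools ] ∑[ s⁺ ∈ fns ] ∑[ t⁺ ∈ fns ] (if local x y then term x y s⁺ t⁺ else 0)
    ≡⟨ ∑-cong bools (λ x → ∑-cong bools λ y → trans (∑-cong fns λ s⁺ → ∑-if (local x y) fns (term x y s⁺))
         (∑-if (local x y) fns λ s⁺ → ∑[ t⁺ ∈ fns ] term x y s⁺ t⁺)) ⟩
  ∑[ x ∈ bools ] ∑[ y ∈ bools ] (if local x y then ∑[ s⁺ ∈ fns ] ∑[ t⁺ ∈ fns ] term x y s⁺ t⁺ else 0)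
    ≡⟨ ∑-cong bools (λ x → ∑-cong bools λ y → cong₂ (λ b n → if b then n else 0)
         (balancedAt≡allowed (o zero) (i zero) x y) (attachments-shift m o′ i′ x (not y) A B)) ⟩
  extend (attachments m o′ i′) (kind (o zero) (i zero)) A B ∎
  where
  open ≡-Reasoning
  fns : List (Fin m → Bool)
  fns = allFns m bools
  o′ i′ : Fin m → ℕ
  o′ v = o (suc v)
  i′ v = i (suc v)
  local : Bool → Bool → Bool
  local x y = balancedAt x y (o zero) (i zero)
  degrees : Bool → (Fin m → Bool) → (Fin (suc m) → Bool) → Bool
  degrees x s⁺ t⁺ = (countFin (suc m) (x ∷ᶠ s⁺) ≡ᵇ A) ∧ (countFin (suc m) (not ∘ t⁺) ≡ᵇ B)
  degrees′ : Bool → Bool → (Fin m → Bool) → (Fin m → Bool) → Bool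
  degrees′ x y s⁺ t⁺ = (ι x + countFin m s⁺ ≡ᵇ A) ∧ (ι (not y) + countFin m (not ∘ t⁺) ≡ᵇ B)
  term : Bool → Bool → (Fin m → Bool) → (Fin m → Bool) → ℕ
  term x y s⁺ t⁺ = ι (balanced m o′ i′ s⁺ t⁺ ∧ degrees′ x y s⁺ t⁺)

attachments≡ways : ∀ m o i A B → attachments m o i A B ≡ ways (censusOf m o i) A B
attachments≡ways zero o i zero zero = refl
attachments≡ways zero o i zero (suc B) = refl
attachments≡ways zero o i (suc A) zero = refl
attachments≡ways zero o i (suc A) (suc B) = sym (trans (*-identityˡ _) (*-zeroʳ (ι (A + 0 ≡ᵇ B + 0))))
attachments≡ways (suc m) o i A B = begin
  attachments (suc m) o i A B
    ≡⟨ attachments-suc m o i A B ⟩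
  extend (attachments m o′ i′) κ A B
    ≡⟨ extend-cong κ A B (attachments≡ways m o′ i′) ⟩
  extend (ways (censusOf m o′ i′)) κ A B
    ≡⟨ extend-ways κ (censusOf m o′ i′) A B ⟩
  ways (censusOf (suc m) o i) A B ∎
  where
  open ≡-Reasoning
  o′ i′ : Fin m → ℕ
  o′ v = o (suc v)
  i′ v = i (suc v)
  κ : Kind
  κ = kind (o zero) (i zero)

ways-diagonal : ∀ ok z p q A →
  ways (census ok z p q) A A ≡ (if ok ∧ (q ≡ᵇ p) then shiftedBinom z p A else 0)
ways-diagonal false z p q A = refl
ways-diagonal true z p q A rewrite +-≡ᵇ-cancelˡ A q p with q ≡ᵇ p
... | true = trans (*-identityˡ _) (*-identityˡ _)
... | false = refl

ways-sym : ∀ c m A B → (consistent c ≡ true → size c ≡ m) → A + B ≡ m → ways c A A ≡ ways c B B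
ways-sym (census ok z p q) m A B size≡m A+B≡m
  rewrite ways-diagonal ok z p q A | ways-diagonal ok z p q B with ok | q ≡ᵇ p in q≡ᵇp
... | false | _ = refl
... | true | false = refl
... | true | true with ≡ᵇ-true⇒≡ q p q≡ᵇp
...   | refl = shiftedBinom-sym z q A B (trans A+B≡m (sym (size≡m refl)))

ways-ratio : ∀ c m h → (consistent c ≡ true → size c ≡ m) → suc m ≤ h + h →
  ways c (suc h) (suc h) * binom m h ≤ ways c h h * binom m (suc h)
ways-ratio (census ok z p q) m h size≡m m<2h
  rewrite ways-diagonal ok z p q h | ways-diagonal ok z p q (suc h) with ok | q ≡ᵇ p in q≡ᵇp
... | false | _ = z≤n
... | true | false = z≤n
... | true | true with ≡ᵇ-true⇒≡ q p q≡ᵇp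
...   | refl rewrite sym (size≡m refl) = shiftedBinom-ratio z q h m<2h

-- Digraphs on V ∪ {s, t}

-- The rows of s, t and of v ∈ V are (a, b, s⁺), (c, d, t⁺) and (s⁻ v, t⁻ v, G v).
join : {m : ℕ} (a b c d : Bool) (s⁺ t⁺ s⁻ t⁻ : Fin m → Bool) → Digraph m → Digraph (2 + m)
join a b c d s⁺ t⁺ s⁻ t⁻ G = (a ∷ᶠ (b ∷ᶠ s⁺)) ∷ᶠ ((c ∷ᶠ (d ∷ᶠ t⁺)) ∷ᶠ λ v → s⁻ v ∷ᶠ (t⁻ v ∷ᶠ G v))

-- Digraphs are functions, compared pointwise: there is no function extensionality.
Congruent : {n : ℕ} {B : Set} → (Digraph n → B) → Set
Congruent F = ∀ D D′ → D ≗₂ D′ → F D ≡ F D′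

∑-row : (m : ℕ) (F : (Fin (2 + m) → Bool) → ℕ) →
  ∑ (allFns (2 + m) bools) F ≡ ∑[ a ∈ bools ] ∑[ b ∈ bools ] ∑[ r ∈ allFns m bools ] F (a ∷ᶠ (b ∷ᶠ r))
∑-row m F = trans (∑-allFns-suc (suc m) bools F) (∑-cong bools λ a → ∑-allFns-suc m bools λ r → F (a ∷ᶠ r))

∑-columns : (m : ℕ) (F : (Fin m → Fin (2 + m) → Bool) → ℕ) → (∀ R R′ → R ≗₂ R′ → F R ≡ F R′) →
  ∑ (allFns m (allFns (2 + m) bools)) F ≡
  ∑[ s⁻ ∈ allFns m bools ] ∑[ t⁻ ∈ allFns m bools ] ∑[ G ∈ allDigraphs m ] F (λ v → s⁻ v ∷ᶠ (t⁻ v ∷ᶠ G v))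
∑-columns m F F-cong = trans (∑-allFns-columns (suc m) m bools F F-cong)
  (∑-cong (allFns m bools) λ s⁻ → ∑-allFns-columns m m bools (λ R → F (λ v → s⁻ v ∷ᶠ R v))
    λ R R′ R≗R′ → F-cong _ _ λ { v zero → refl ; v (suc w) → R≗R′ v w })

∑-joins : (m : ℕ) → (Digraph (2 + m) → ℕ) → Bool → Bool → Bool → Bool → ℕ
∑-joins m F a b c d = ∑[ s⁺ ∈ allFns m bools ] ∑[ t⁺ ∈ allFns m bools ] ∑[ s⁻ ∈ allFns m bools ]
  ∑[ t⁻ ∈ allFns m bools ] ∑[ G ∈ allDigraphs m ] F (join a b c d s⁺ t⁺ s⁻ t⁻ G)

∑-digraphs : (m : ℕ) (F : Digraph (2 + m) → ℕ) → Congruent F →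
  ∑ (allDigraphs (2 + m)) F ≡ ∑[ a ∈ bools ] ∑[ b ∈ bools ] ∑[ c ∈ bools ] ∑[ d ∈ bools ] ∑-joins m F a b c d
∑-digraphs m F F-cong = begin
  ∑ (allDigraphs (2 + m)) F
    ≡⟨ ∑-allFns-suc (suc m) rows F ⟩
  ∑[ r ∈ rows ] ∑[ R ∈ allFns (suc m) rows ] F (r ∷ᶠ R)
    ≡⟨ ∑-cong rows (λ r → ∑-allFns-suc m rows _) ⟩
  ∑[ r ∈ rows ] ∑[ r′ ∈ rows ] ∑[ R ∈ allFns m rows ] F (r ∷ᶠ (r′ ∷ᶠ R))
    ≡⟨ ∑-row m _ ⟩
  ∑[ a ∈ bools ] ∑[ b ∈ bools ] ∑[ s⁺ ∈ fns ] ∑[ r′ ∈ rows ] ∑[ R ∈ allFns m rows ]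
    F ((a ∷ᶠ (b ∷ᶠ s⁺)) ∷ᶠ (r′ ∷ᶠ R))
    ≡⟨ ∑-cong bools (λ a → ∑-cong bools λ b → ∑-cong fns λ s⁺ →
         ∑-row m λ r′ → ∑[ R ∈ allFns m rows ] F ((a ∷ᶠ (b ∷ᶠ s⁺)) ∷ᶠ (r′ ∷ᶠ R))) ⟩
  ∑[ a ∈ bools ] ∑[ b ∈ bools ] ∑[ s⁺ ∈ fns ] ∑[ c ∈ bools ] ∑[ d ∈ bools ] ∑[ t⁺ ∈ fns ]
    ∑[ R ∈ allFns m rows ] F ((a ∷ᶠ (b ∷ᶠ s⁺)) ∷ᶠ ((c ∷ᶠ (d ∷ᶠ t⁺)) ∷ᶠ R))
    ≡⟨ ∑-cong bools (λ a → ∑-cong bools λ b → ∑-cong fns λ s⁺ → ∑-cong bools λ c → ∑-cong bools λ d →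
         ∑-cong fns λ t⁺ → ∑-columns m (λ R → F ((a ∷ᶠ (b ∷ᶠ s⁺)) ∷ᶠ ((c ∷ᶠ (d ∷ᶠ t⁺)) ∷ᶠ R)))
           λ R R′ R≗R′ → F-cong _ _
           λ { zero w → refl ; (suc zero) w → refl ; (suc (suc v)) w → R≗R′ v w }) ⟩
  ∑[ a ∈ bools ] ∑[ b ∈ bools ] ∑[ s⁺ ∈ fns ] ∑[ c ∈ bools ] ∑[ d ∈ bools ] joins a b c d s⁺
    ≡⟨ ∑-cong bools (λ a → ∑-cong bools λ b → trans (∑-comm fns bools λ s⁺ c → ∑[ d ∈ bools ] joins a b c d s⁺)
         (∑-cong bools λ c → ∑-comm fns bools λ s⁺ d → joins a b c d s⁺)) ⟩
  ∑[ a ∈ bools ] ∑[ b ∈ bools ] ∑[ c ∈ bools ] ∑[ d ∈ bools ] ∑-joins m F a b c d ∎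
  where
  open ≡-Reasoning
  rows : List (Fin (2 + m) → Bool)
  rows = allFns (2 + m) bools
  fns : List (Fin m → Bool)
  fns = allFns m bools
  joins : Bool → Bool → Bool → Bool → (Fin m → Bool) → ℕ
  joins a b c d s⁺ = ∑[ t⁺ ∈ fns ] ∑[ s⁻ ∈ fns ] ∑[ t⁻ ∈ fns ] ∑[ G ∈ allDigraphs m ]
    F (join a b c d s⁺ t⁺ s⁻ t⁻ G)

∑-joins-zero : ∀ m F a b c d → (∀ s⁺ t⁺ s⁻ t⁻ G → F (join a b c d s⁺ t⁺ s⁻ t⁻ G) ≡ 0) →
  ∑-joins m F a b c d ≡ 0
∑-joins-zero m F a b c d F≡0 =
  ∑-zero (allFns m bools) λ s⁺ → ∑-zero (allFns m bools) λ t⁺ → ∑-zero (allFns m bools) λ s⁻ →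
  ∑-zero (allFns m bools) λ t⁻ → ∑-zero (allDigraphs m) λ G → F≡0 s⁺ t⁺ s⁻ t⁻ G

Oriented : {m : ℕ} → (Digraph (2 + m) → Bool) → Set
Oriented {m} P = ∀ D → P D ≡ true → ∀ (v : Fin m) →
  (D sV (suc (suc v)) xor D (suc (suc v)) sV) ≡ true × (D tV (suc (suc v)) xor D (suc (suc v)) tV) ≡ true

∑-joins-oriented : ∀ m (P : Digraph (2 + m) → Bool) → Congruent P → Oriented P →
  ∀ a b c d → ∑-joins m (ι ∘ P) a b c d ≡
  ∑[ G ∈ allDigraphs m ] ∑[ s⁺ ∈ allFns m bools ] ∑[ t⁺ ∈ allFns m bools ]
    ι (P (join a b c d s⁺ t⁺ (not ∘ s⁺) (not ∘ t⁺) G))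
∑-joins-oriented m P P-cong oriented a b c d = begin
  ∑-joins m (ι ∘ P) a b c d
    ≡⟨ ∑-cong fns (λ s⁺ → ∑-cong fns λ t⁺ → ∑-cong fns λ s⁻ →
         ∑-forced m (λ t⁻ → ∑[ G ∈ allDigraphs m ] ι (P (join a b c d s⁺ t⁺ s⁻ t⁻ G))) (not ∘ t⁺)
           (λ t⁻ t⁻′ t⁻≗t⁻′ → ∑-cong (allDigraphs m) λ G → cong ι (P-cong _ _
             λ { zero w → refl ; (suc zero) w → refl ; (suc (suc v)) zero → refl
               ; (suc (suc v)) (suc zero) → t⁻≗t⁻′ v ; (suc (suc v)) (suc (suc w)) → refl }))
           λ t⁻ v t⁺≢t⁻ → ∑-zero (allDigraphs m) λ G → ι≡0 _ λ P-D →
             t⁺≢t⁻ (xor-true (t⁺ v) (t⁻ v) (proj₂ (oriented _ P-D v)))) ⟩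
  ∑[ s⁺ ∈ fns ] ∑[ t⁺ ∈ fns ] ∑[ s⁻ ∈ fns ] ∑[ G ∈ allDigraphs m ]
    ι (P (join a b c d s⁺ t⁺ s⁻ (not ∘ t⁺) G))
    ≡⟨ ∑-cong fns (λ s⁺ → ∑-cong fns λ t⁺ →
         ∑-forced m (λ s⁻ → ∑[ G ∈ allDigraphs m ] ι (P (join a b c d s⁺ t⁺ s⁻ (not ∘ t⁺) G))) (not ∘ s⁺)
           (λ s⁻ s⁻′ s⁻≗s⁻′ → ∑-cong (allDigraphs m) λ G → cong ι (P-cong _ _
             λ { zero w → refl ; (suc zero) w → refl ; (suc (suc v)) zero → s⁻≗s⁻′ v
               ; (suc (suc v)) (suc zero) → refl ; (suc (suc v)) (suc (suc w)) → refl }))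
           λ s⁻ v s⁺≢s⁻ → ∑-zero (allDigraphs m) λ G → ι≡0 _ λ P-D →
             s⁺≢s⁻ (xor-true (s⁺ v) (s⁻ v) (proj₁ (oriented _ P-D v)))) ⟩
  ∑[ s⁺ ∈ fns ] ∑[ t⁺ ∈ fns ] ∑[ G ∈ allDigraphs m ] term G s⁺ t⁺
    ≡⟨ ∑-cong fns (λ s⁺ → ∑-comm fns (allDigraphs m) λ t⁺ G → term G s⁺ t⁺) ⟩
  ∑[ s⁺ ∈ fns ] ∑[ G ∈ allDigraphs m ] ∑[ t⁺ ∈ fns ] term G s⁺ t⁺
    ≡⟨ ∑-comm fns (allDigraphs m) (λ s⁺ G → ∑[ t⁺ ∈ fns ] term G s⁺ t⁺) ⟩
  ∑[ G ∈ allDigraphs m ] ∑[ s⁺ ∈ fns ] ∑[ t⁺ ∈ fns ] term G s⁺ t⁺ ∎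
  where
  open ≡-Reasoning
  fns : List (Fin m → Bool)
  fns = allFns m bools
  term : Digraph m → (s⁺ t⁺ : Fin m → Bool) → ℕ
  term G s⁺ t⁺ = ι (P (join a b c d s⁺ t⁺ (not ∘ s⁺) (not ∘ t⁺) G))

tPair : {n : ℕ} → Digraph n → Fin n → Fin n → Bool
tPair D u v = if does (u Fin.≟ v) then not (D u u) else (D u v xor D v u)

tPair-cong : ∀ {n} {D D′ : Digraph n} → D ≗₂ D′ → tPair D ≗₂ tPair D′
tPair-cong D≗D′ u v rewrite D≗D′ u u | D≗D′ u v | D≗D′ v u = refl

-- The pair conditions of isA and of isTournament on a joined digraph with s⁻ = not ∘ s⁺ and t⁻ = not ∘ t⁺.
complementary-pairs : ∀ m (s⁺ t⁺ : Fin m → Bool) (G : Digraph m) →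
  allFin m (λ w → s⁺ w xor not (s⁺ w)) ∧ (allFin m (λ w → t⁺ w xor not (t⁺ w)) ∧
    allFin m (λ v → (not (s⁺ v) xor s⁺ v) ∧ ((not (t⁺ v) xor t⁺ v) ∧ allFin m (tPair G v))))
  ≡ isTournament m G
complementary-pairs m s⁺ t⁺ G = cong₂ _∧_ (trans (allFin-cong m (xor-inverseʳ ∘ s⁺)) (allFin-true m))
  (cong₂ _∧_ (trans (allFin-cong m (xor-inverseʳ ∘ t⁺)) (allFin-true m))
    (allFin-cong m λ v → cong₂ _∧_ (xor-inverseˡ (s⁺ v)) (cong₂ _∧_ (xor-inverseˡ (t⁺ v)) refl)))

isExtension : (m h : ℕ) → Digraph m → (s⁺ t⁺ : Fin m → Bool) → Bool
isExtension m h G s⁺ t⁺ =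
  isTournament m G ∧ (balanced m (outdeg G) (indeg G) s⁺ t⁺ ∧ ((countFin m s⁺ ≡ᵇ h) ∧ (countFin m (not ∘ t⁺) ≡ᵇ h)))

extensions : ℕ → ℕ → ℕ
extensions m h = ∑[ G ∈ allDigraphs m ] ι (isTournament m G) * attachments m (outdeg G) (indeg G) h h

∑-extensions : ∀ m h → ∑[ G ∈ allDigraphs m ] ∑[ s⁺ ∈ allFns m bools ] ∑[ t⁺ ∈ allFns m bools ]
    ι (isExtension m h G s⁺ t⁺)
  ≡ extensions m h
∑-extensions m h = ∑-cong (allDigraphs m) λ G → trans
  (∑-cong (allFns m bools) λ s⁺ → trans (∑-cong (allFns m bools) λ t⁺ → ι-∧ (isTournament m G) _)
    (∑-*ˡ (allFns m bools) (ι (isTournament m G)) _))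
  (∑-*ˡ (allFns m bools) (ι (isTournament m G)) _)

extensions-sym : ∀ m h k → h + k ≡ m → extensions m h ≡ extensions m k
extensions-sym m h k h+k≡m = ∑-cong (allDigraphs m) λ G → cong (ι (isTournament m G) *_) (begin
  attachments m (outdeg G) (indeg G) h h       ≡⟨ attachments≡ways m (outdeg G) (indeg G) h h ⟩
  ways (censusOf m (outdeg G) (indeg G)) h h   ≡⟨ ways-sym _ m h k (censusOf-size m (outdeg G) (indeg G)) h+k≡m ⟩
  ways (censusOf m (outdeg G) (indeg G)) k k   ≡⟨ attachments≡ways m (outdeg G) (indeg G) k k ⟨
  attachments m (outdeg G) (indeg G) k k       ∎)
  where open ≡-Reasoning

extensions-ratio : ∀ m h → suc m ≤ h + h →
  extensions m (suc h) * binom m h ≤ extensions m h * binom m (suc h)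
extensions-ratio m h m<2h = begin
  extensions m (suc h) * binom m h
    ≡⟨ ∑-*ʳ (allDigraphs m) (binom m h) (λ G → ι (isTournament m G) * count G (suc h)) ⟨
  ∑[ G ∈ allDigraphs m ] (ι (isTournament m G) * count G (suc h) * binom m h)
    ≤⟨ ∑-mono (allDigraphs m) (λ G → begin
         ι (isTournament m G) * count G (suc h) * binom m h   ≡⟨ *-assoc (ι (isTournament m G)) _ _ ⟩
         ι (isTournament m G) * (count G (suc h) * binom m h) ≤⟨ *-monoʳ-≤ (ι (isTournament m G)) (per-tournament G) ⟩
         ι (isTournament m G) * (count G h * binom m (suc h)) ≡⟨ *-assoc (ι (isTournament m G)) _ _ ⟨
         ι (isTournament m G) * count G h * binom m (suc h)   ∎) ⟩
  ∑[ G ∈ allDigraphs m ] (ι (isTournament m G) * count G h * binom m (suc h))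
    ≡⟨ ∑-*ʳ (allDigraphs m) (binom m (suc h)) (λ G → ι (isTournament m G) * count G h) ⟩
  extensions m h * binom m (suc h) ∎
  where
  open ≤-Reasoning
  count : Digraph m → ℕ → ℕ
  count G h = attachments m (outdeg G) (indeg G) h h
  per-tournament : ∀ G → count G (suc h) * binom m h ≤ count G h * binom m (suc h)
  per-tournament G = subst₂ _≤_
    (cong (_* binom m h) (sym (attachments≡ways m (outdeg G) (indeg G) (suc h) (suc h))))
    (cong (_* binom m (suc h)) (sym (attachments≡ways m (outdeg G) (indeg G) h h)))
    (ways-ratio _ m h (censusOf-size m (outdeg G) (indeg G)) m<2h)

-- a m f and RT (m + 2) as sums over tournaments

stPair : {m : ℕ} → Digraph (2 + m) → Fin (2 + m) → Fin (2 + m) → Bool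
stPair D u v = if does (u Fin.≟ v) then not (D u u) else
  (if isST u v then not (D u v) ∧ not (D v u) else (D u v xor D v u))

stPair-cong : ∀ {m} {D D′ : Digraph (2 + m)} → D ≗₂ D′ → stPair D ≗₂ stPair D′
stPair-cong D≗D′ u v rewrite D≗D′ u u | D≗D′ u v | D≗D′ v u = refl

isA-cong : ∀ m f → Congruent (isA m f)
isA-cong m f D D′ D≗D′ =
  cong₂ _∧_ (allFin-cong (2 + m) λ u → allFin-cong (2 + m) (stPair-cong D≗D′ u)) (
  cong₂ _∧_ (allFin-cong m λ v → cong₂ (λ x y → does (x ℕ.≟ y)) (outs _) (ins _)) (
  cong₂ _∧_ (cong (λ x → does (ℤ.+ (2 * x) ℤ.≟ ℤ.+ m ℤ.+ f)) (outs sV)) (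
  cong₂ _∧_ (cong (λ x → does (ℤ.+ (2 * x) ℤ.≟ ℤ.+ m ℤ.+ f)) (ins tV)) (
  cong₂ _∧_ (cong (λ x → does (ℤ.+ (2 * x) ℤ.≟ ℤ.+ m ℤ.- f)) (ins sV))
            (cong (λ x → does (ℤ.+ (2 * x) ℤ.≟ ℤ.+ m ℤ.- f)) (outs tV))))))
  where
  outs : ∀ u → outdeg D u ≡ outdeg D′ u
  outs u = countFin-cong (2 + m) (D≗D′ u)
  ins : ∀ u → indeg D u ≡ indeg D′ u
  ins u = countFin-cong (2 + m) (λ v → D≗D′ v u)

isA-oriented : ∀ m f → Oriented (isA m f)
isA-oriented m f D isA-D v = pair zero , pair (suc zero)
  where
  pair : ∀ u → stPair D u (suc (suc v)) ≡ true
  pair u = allFin-elim (2 + m) {stPair D u}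
    (allFin-elim (2 + m) {λ u → allFin (2 + m) (stPair D u)} (proj₁ (∧-true isA-D)) u) (suc (suc v))

isA-join : ∀ m f h k → ℤ.+ m ℤ.+ f ≡ ℤ.+ (h + h) → ℤ.+ m ℤ.- f ≡ ℤ.+ (k + k) → h + k ≡ m →
  ∀ s⁺ t⁺ G → isA m f (join false false false false s⁺ t⁺ (not ∘ s⁺) (not ∘ t⁺) G) ≡
  isExtension m h G s⁺ t⁺
isA-join m f h k m+f≡2h m-f≡2k h+k≡m s⁺ t⁺ G =
  cong₂ _∧_ (complementary-pairs m s⁺ t⁺ G) (cong (balanced m (outdeg G) (indeg G) s⁺ t⁺ ∧_) degrees)
  where
  halfOf : ∀ z x y → z ≡ ℤ.+ (y + y) → does (ℤ.+ (2 * x) ℤ.≟ z) ≡ (x ≡ᵇ y)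
  halfOf z x y refl = double-≡ᵇ x y
  degrees : does (ℤ.+ (2 * countFin m s⁺) ℤ.≟ ℤ.+ m ℤ.+ f) ∧ (does (ℤ.+ (2 * countFin m (not ∘ t⁺)) ℤ.≟ ℤ.+ m ℤ.+ f) ∧
              (does (ℤ.+ (2 * countFin m (not ∘ s⁺)) ℤ.≟ ℤ.+ m ℤ.- f) ∧ does (ℤ.+ (2 * countFin m t⁺) ℤ.≟ ℤ.+ m ℤ.- f)))
            ≡ (countFin m s⁺ ≡ᵇ h) ∧ (countFin m (not ∘ t⁺) ≡ᵇ h)
  degrees = trans
    (cong₂ _∧_ (halfOf _ (countFin m s⁺) h m+f≡2h) (cong₂ _∧_ (halfOf _ (countFin m (not ∘ t⁺)) h m+f≡2h)
      (cong₂ _∧_ (halfOf _ (countFin m (not ∘ s⁺)) k m-f≡2k) (halfOf _ (countFin m t⁺) k m-f≡2k))))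
    (∧-absorb (complement-≡ᵇ (countFin m s⁺) (countFin m (not ∘ s⁺)) h k (countFin-not m s⁺) h+k≡m)
              (complement-≡ᵇ (countFin m (not ∘ t⁺)) (countFin m t⁺) h k
                (trans (+-comm _ (countFin m t⁺)) (countFin-not m t⁺)) h+k≡m))

a≡∑-joins : ∀ m f → a m f ≡ ∑-joins m (ι ∘ isA m f) false false false false
a≡∑-joins m f = begin
  a m f
    ≡⟨ length-filterᵇ (isA m f) (allDigraphs (2 + m)) ⟩
  ∑ (allDigraphs (2 + m)) (ι ∘ isA m f)
    ≡⟨ ∑-digraphs m (ι ∘ isA m f) (λ D D′ D≗D′ → cong ι (isA-cong m f D D′ D≗D′)) ⟩
  ∑[ a ∈ bools ] ∑[ b ∈ bools ] ∑[ c ∈ bools ] ∑[ d ∈ bools ] joins a b c d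
    ≡⟨ ∑-bools-at false (λ a → ∑[ b ∈ bools ] ∑[ c ∈ bools ] ∑[ d ∈ bools ] joins a b c d)
         (∑-zero bools λ b → ∑-zero bools λ c → ∑-zero bools λ d → zero-if true b c d λ _ _ _ _ _ → refl) ⟩
  ∑[ b ∈ bools ] ∑[ c ∈ bools ] ∑[ d ∈ bools ] joins false b c d
    ≡⟨ ∑-bools-at false (λ b → ∑[ c ∈ bools ] ∑[ d ∈ bools ] joins false b c d)
         (∑-zero bools λ c → ∑-zero bools λ d → zero-if false true c d λ _ _ _ _ _ → refl) ⟩
  ∑[ c ∈ bools ] ∑[ d ∈ bools ] joins false false c d
    ≡⟨ ∑-bools-at false (λ c → ∑[ d ∈ bools ] joins false false c d)
         (∑-zero bools λ d → zero-if false false true d λ _ _ _ _ _ → refl) ⟩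
  ∑[ d ∈ bools ] joins false false false d
    ≡⟨ ∑-bools-at false (joins false false false) (zero-if false false false true λ s⁺ _ s⁻ _ _ →
         ι-∧-false (allFin m λ v → s⁺ v xor s⁻ v) _) ⟩
  joins false false false false ∎
  where
  open ≡-Reasoning
  joins : Bool → Bool → Bool → Bool → ℕ
  joins = ∑-joins m (ι ∘ isA m f)
  zero-if : ∀ a b c d → (∀ s⁺ t⁺ s⁻ t⁻ G → ι (isA m f (join a b c d s⁺ t⁺ s⁻ t⁻ G)) ≡ 0) → joins a b c d ≡ 0
  zero-if = ∑-joins-zero m (ι ∘ isA m f)

a≡extensions : ∀ m f h k → ℤ.+ m ℤ.+ f ≡ ℤ.+ (h + h) → ℤ.+ m ℤ.- f ≡ ℤ.+ (k + k) → h + k ≡ m →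
  a m f ≡ extensions m h
a≡extensions m f h k m+f≡2h m-f≡2k h+k≡m = begin
  a m f
    ≡⟨ a≡∑-joins m f ⟩
  ∑-joins m (ι ∘ isA m f) false false false false
    ≡⟨ ∑-joins-oriented m (isA m f) (isA-cong m f) (isA-oriented m f) false false false false ⟩
  ∑[ G ∈ allDigraphs m ] ∑[ s⁺ ∈ allFns m bools ] ∑[ t⁺ ∈ allFns m bools ]
    ι (isA m f (join false false false false s⁺ t⁺ (not ∘ s⁺) (not ∘ t⁺) G))
    ≡⟨ ∑-cong (allDigraphs m) (λ G → ∑-cong (allFns m bools) λ s⁺ → ∑-cong (allFns m bools) λ t⁺ →
         cong ι (isA-join m f h k m+f≡2h m-f≡2k h+k≡m s⁺ t⁺ G)) ⟩
  ∑[ G ∈ allDigraphs m ] ∑[ s⁺ ∈ allFns m bools ] ∑[ t⁺ ∈ allFns m bools ]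
    ι (isExtension m h G s⁺ t⁺)
    ≡⟨ ∑-extensions m h ⟩
  extensions m h ∎
  where open ≡-Reasoning

regularTournament : (n : ℕ) → Digraph n → Bool
regularTournament n D = isTournament n D ∧ isRegular n D

regularTournament-cong : ∀ n → Congruent (regularTournament n)
regularTournament-cong n D D′ D≗D′ = cong₂ _∧_
  (allFin-cong n λ u → allFin-cong n (tPair-cong D≗D′ u))
  (allFin-cong n λ v → cong₂ (λ x y → does (x ℕ.≟ y)) (countFin-cong n (D≗D′ v)) (countFin-cong n λ u → D≗D′ u v))

regularTournament-oriented : ∀ m → Oriented (regularTournament (2 + m))
regularTournament-oriented m D RT-D v = pair zero , pair (suc zero)
  where
  pair : ∀ u → tPair D u (suc (suc v)) ≡ true
  pair u = allFin-elim (2 + m) {tPair D u}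
    (allFin-elim (2 + m) {λ u → allFin (2 + m) (tPair D u)} (proj₁ (∧-true RT-D)) u) (suc (suc v))

regularTournament-join : ∀ m (b c : Bool) (h : ℕ) (s⁺ t⁺ : Fin m → Bool) (G : Digraph m) → b xor c ≡ true →
  (ι b + countFin m s⁺ ≡ᵇ ι c + countFin m (not ∘ s⁺)) ≡ (countFin m s⁺ ≡ᵇ h) →
  (ι c + countFin m t⁺ ≡ᵇ ι b + countFin m (not ∘ t⁺)) ≡ (countFin m (not ∘ t⁺) ≡ᵇ h) →
  regularTournament (2 + m) (join false b c false s⁺ t⁺ (not ∘ s⁺) (not ∘ t⁺) G) ≡
  isExtension m h G s⁺ t⁺
regularTournament-join m true false h s⁺ t⁺ G _ s-regular t-regular =
  cong₂ _∧_ (complementary-pairs m s⁺ t⁺ G) (trans (cong₂ _∧_ s-regular (cong₂ _∧_ t-regular refl))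
    (∧-rotate (countFin m s⁺ ≡ᵇ h) (countFin m (not ∘ t⁺) ≡ᵇ h) (balanced m (outdeg G) (indeg G) s⁺ t⁺)))
regularTournament-join m false true h s⁺ t⁺ G _ s-regular t-regular =
  cong₂ _∧_ (complementary-pairs m s⁺ t⁺ G) (trans (cong₂ _∧_ s-regular (cong₂ _∧_ t-regular refl))
    (∧-rotate (countFin m s⁺ ≡ᵇ h) (countFin m (not ∘ t⁺) ≡ᵇ h) (balanced m (outdeg G) (indeg G) s⁺ t⁺)))

RT≡∑-joins : ∀ m → RT (2 + m) ≡ ∑-joins m (ι ∘ regularTournament (2 + m)) false true false false
                                + ∑-joins m (ι ∘ regularTournament (2 + m)) false false true false
RT≡∑-joins m = begin
  RT (2 + m)
    ≡⟨ length-filterᵇ (regularTournament (2 + m)) (allDigraphs (2 + m)) ⟩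
  ∑ (allDigraphs (2 + m)) (ι ∘ regularTournament (2 + m))
    ≡⟨ ∑-digraphs m _ (λ D D′ D≗D′ → cong ι (regularTournament-cong (2 + m) D D′ D≗D′)) ⟩
  ∑[ a ∈ bools ] ∑[ b ∈ bools ] ∑[ c ∈ bools ] ∑[ d ∈ bools ] joins a b c d
    ≡⟨ ∑-bools-at false (λ a → ∑[ b ∈ bools ] ∑[ c ∈ bools ] ∑[ d ∈ bools ] joins a b c d)
         (∑-zero bools λ b → ∑-zero bools λ c → ∑-zero bools λ d → zero-if true b c d λ _ _ _ _ _ → refl) ⟩
  ∑[ b ∈ bools ] ∑[ c ∈ bools ] ∑[ d ∈ bools ] joins false b c d
    ≡⟨ ∑-bools (λ b → ∑[ c ∈ bools ] ∑[ d ∈ bools ] joins false b c d) ⟩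
  (∑[ c ∈ bools ] ∑[ d ∈ bools ] joins false true c d) + (∑[ c ∈ bools ] ∑[ d ∈ bools ] joins false false c d)
    ≡⟨ cong₂ _+_
         (∑-bools-at false (λ c → ∑[ d ∈ bools ] joins false true c d)
           (∑-zero bools λ d → zero-if false true true d λ _ _ _ _ _ → refl))
         (∑-bools-at true (λ c → ∑[ d ∈ bools ] joins false false c d)
           (∑-zero bools λ d → zero-if false false false d λ _ _ _ _ _ → refl)) ⟩
  (∑[ d ∈ bools ] joins false true false d) + (∑[ d ∈ bools ] joins false false true d)
    ≡⟨ cong₂ _+_
         (∑-bools-at false (joins false true false)
           (zero-if false true false true λ s⁺ _ s⁻ _ _ → ι-∧-false (allFin m λ v → s⁺ v xor s⁻ v) _))
         (∑-bools-at false (joins false false true)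
           (zero-if false false true true λ s⁺ _ s⁻ _ _ → ι-∧-false (allFin m λ v → s⁺ v xor s⁻ v) _)) ⟩
  joins false true false false + joins false false true false ∎
  where
  open ≡-Reasoning
  joins : Bool → Bool → Bool → Bool → ℕ
  joins = ∑-joins m (ι ∘ regularTournament (2 + m))
  zero-if : ∀ a b c d → (∀ s⁺ t⁺ s⁻ t⁻ G → ι (regularTournament (2 + m) (join a b c d s⁺ t⁺ s⁻ t⁻ G)) ≡ 0) →
    joins a b c d ≡ 0
  zero-if = ∑-joins-zero m (ι ∘ regularTournament (2 + m))

∑-joins-regularTournament : ∀ m b c h → b xor c ≡ true →
  (∀ s⁺ → (ι b + countFin m s⁺ ≡ᵇ ι c + countFin m (not ∘ s⁺)) ≡ (countFin m s⁺ ≡ᵇ h)) →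
  (∀ t⁺ → (ι c + countFin m t⁺ ≡ᵇ ι b + countFin m (not ∘ t⁺)) ≡ (countFin m (not ∘ t⁺) ≡ᵇ h)) →
  ∑-joins m (ι ∘ regularTournament (2 + m)) false b c false ≡ extensions m h
∑-joins-regularTournament m b c h b≠c s-regular t-regular = begin
  ∑-joins m (ι ∘ regularTournament (2 + m)) false b c false
    ≡⟨ ∑-joins-oriented m (regularTournament (2 + m)) (regularTournament-cong (2 + m))
         (regularTournament-oriented m) false b c false ⟩
  ∑[ G ∈ allDigraphs m ] ∑[ s⁺ ∈ allFns m bools ] ∑[ t⁺ ∈ allFns m bools ]
    ι (regularTournament (2 + m) (join false b c false s⁺ t⁺ (not ∘ s⁺) (not ∘ t⁺) G))
    ≡⟨ ∑-cong (allDigraphs m) (λ G → ∑-cong (allFns m bools) λ s⁺ → ∑-cong (allFns m bools) λ t⁺ →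
         cong ι (regularTournament-join m b c h s⁺ t⁺ G b≠c (s-regular s⁺) (t-regular t⁺))) ⟩
  ∑[ G ∈ allDigraphs m ] ∑[ s⁺ ∈ allFns m bools ] ∑[ t⁺ ∈ allFns m bools ]
    ι (isExtension m h G s⁺ t⁺)
    ≡⟨ ∑-extensions m h ⟩
  extensions m h ∎
  where open ≡-Reasoning

-- Regularity of s forces its out-degree inside V to be k if s → t and k + 1 if t → s.
RT≡extensions : ∀ m k → m ≡ suc (k + k) → RT (2 + m) ≡ extensions m k + extensions m (suc k)
RT≡extensions m k m≡2k+1 = trans (RT≡∑-joins m) (cong₂ _+_
  (∑-joins-regularTournament m true false k refl
    (λ s⁺ → trans (≡ᵇ-comm (suc (countFin m s⁺)) (countFin m (not ∘ s⁺)))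
                  (odd-split-below (countFin m s⁺) _ k (split s⁺)))
    (λ t⁺ → odd-split-below (countFin m (not ∘ t⁺)) _ k (split′ t⁺)))
  (∑-joins-regularTournament m false true (suc k) refl
    (λ s⁺ → odd-split-above (countFin m s⁺) _ k (split s⁺))
    (λ t⁺ → trans (≡ᵇ-comm (suc (countFin m t⁺)) (countFin m (not ∘ t⁺)))
                  (odd-split-above (countFin m (not ∘ t⁺)) _ k (split′ t⁺)))))
  where
  split : ∀ p → countFin m p + countFin m (not ∘ p) ≡ suc (k + k)
  split p = trans (countFin-not m p) m≡2k+1
  split′ : ∀ p → countFin m (not ∘ p) + countFin m p ≡ suc (k + k)
  split′ p = trans (+-comm _ (countFin m p)) (split p)

half-+ : ∀ m n → m % 2 ≡ 1 → n % 2 ≡ 1 → half m (ℤ.+ n) + half m (ℤ.+ n) ≡ m + n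
half-+ m n m-odd n-odd = even-half (m + n) (odd+odd-even m n m-odd n-odd)

half-double : ∀ m f → m % 2 ≡ 1 → ℤ.∣ f ∣ % 2 ≡ 1 → ℤ.∣ f ∣ ≤ m →
  ℤ.+ m ℤ.+ f ≡ ℤ.+ (half m f + half m f)
half-double m (ℤ.+ n) m-odd n-odd _ = cong ℤ.+_ (sym (half-+ m n m-odd n-odd))
half-double m ℤ.-[1+ n ] m-odd n-odd n<m rewrite ℤ.⊖-≥ n<m =
  cong ℤ.+_ (sym (even-half (m ∸ suc n) (odd∸odd-even m (suc n) n<m m-odd n-odd)))

half-double-neg : ∀ m f → m % 2 ≡ 1 → ℤ.∣ f ∣ % 2 ≡ 1 → ℤ.∣ f ∣ ≤ m →
  ℤ.+ m ℤ.- f ≡ ℤ.+ (half m (ℤ.- f) + half m (ℤ.- f))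
half-double-neg m f m-odd f-odd f≤m = half-double m (ℤ.- f) m-odd
  (subst (λ n → n % 2 ≡ 1) (sym (ℤ.∣-i∣≡∣i∣ f)) f-odd) (subst (_≤ m) (sym (ℤ.∣-i∣≡∣i∣ f)) f≤m)

half+half-neg : ∀ m f → m % 2 ≡ 1 → ℤ.∣ f ∣ % 2 ≡ 1 → ℤ.∣ f ∣ ≤ m → half m f + half m (ℤ.- f) ≡ m
half+half-neg m f m-odd f-odd f≤m = double-injective (ℤ.+-injective (begin
  ℤ.+ ((h + k) + (h + k))              ≡⟨ cong ℤ.+_ (interchange h k) ⟩
  ℤ.+ (h + h + (k + k))                ≡⟨ ℤ.pos-+ (h + h) (k + k) ⟩
  ℤ.+ (h + h) ℤ.+ ℤ.+ (k + k)          ≡⟨ cong₂ ℤ._+_ (half-double m f m-odd f-odd f≤m)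
                                                        (half-double-neg m f m-odd f-odd f≤m) ⟨
  (ℤ.+ m ℤ.+ f) ℤ.+ (ℤ.+ m ℤ.- f)      ≡⟨ cancel (ℤ.+ m) f ⟩
  ℤ.+ m ℤ.+ ℤ.+ m                      ≡⟨ ℤ.pos-+ m m ⟨
  ℤ.+ (m + m)                          ∎))
  where
  open ≡-Reasoning
  h k : ℕ
  h = half m f
  k = half m (ℤ.- f)
  interchange : ∀ h k → (h + k) + (h + k) ≡ h + h + (k + k)
  interchange = solve-∀
  cancel : ∀ x f → (x ℤ.+ f) ℤ.+ (x ℤ.- f) ≡ x ℤ.+ x
  cancel = ℤ-Solver.solve-∀

a≡extensions-half : ∀ m f → m % 2 ≡ 1 → ℤ.∣ f ∣ % 2 ≡ 1 → ℤ.∣ f ∣ ≤ m →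
  a m f ≡ extensions m (half m f)
a≡extensions-half m f m-odd f-odd f≤m = a≡extensions m f (half m f) (half m (ℤ.- f))
  (half-double m f m-odd f-odd f≤m) (half-double-neg m f m-odd f-odd f≤m) (half+half-neg m f m-odd f-odd f≤m)

-- Opened only now: the prefix +_ would make sections such as (x +_) above ambiguous.
open import Data.Integer as ℤ using (ℤ; +_; ∣_∣; -_; _-_)

a-neg : ∀ m f → m % 2 ≡ 1 → ∣ f ∣ % 2 ≡ 1 → ∣ f ∣ ≤ m → a m (- f) ≡ a m f
a-neg m f m-odd f-odd f≤m = begin
  a m (- f)
    ≡⟨ a≡extensions m (- f) k h (half-double-neg m f m-odd f-odd f≤m)
         (trans (cong (λ i → + m ℤ.+ i) (ℤ.neg-involutive f)) (half-double m f m-odd f-odd f≤m))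
         (trans (+-comm k h) (half+half-neg m f m-odd f-odd f≤m)) ⟩
  extensions m k ≡⟨ extensions-sym m k h (trans (+-comm k h) (half+half-neg m f m-odd f-odd f≤m)) ⟩
  extensions m h ≡⟨ a≡extensions-half m f m-odd f-odd f≤m ⟨
  a m f          ∎
  where
  open ≡-Reasoning
  h k : ℕ
  h = half m f
  k = half m (- f)

a-ratio-step : ∀ m n → m % 2 ≡ 1 → n % 2 ≡ 1 → 2 + n ≤ m →
  a m (+ (2 + n)) * (m C half m (+ n)) ≤ a m (+ n) * (m C half m (+ (2 + n)))
a-ratio-step m n m-odd n-odd 2+n≤m = begin
  a m (+ (2 + n)) * (m C h)        ≡⟨ cong₂ _*_ (trans (a≡extensions-half m (+ (2 + n)) m-odd 2+n-odd 2+n≤m)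
                                                        (cong (extensions m) h′≡1+h))
                                                 (sym (binom≡C m h)) ⟩
  extensions m (suc h) * binom m h ≤⟨ extensions-ratio m h m<2h ⟩
  extensions m h * binom m (suc h) ≡⟨ cong₂ _*_ (sym (a≡extensions-half m (+ n) m-odd n-odd n≤m))
                                                 (trans (binom≡C m (suc h)) (cong (m C_) (sym h′≡1+h))) ⟩
  a m (+ n) * (m C half m (+ (2 + n))) ∎
  where
  open ≤-Reasoning
  h : ℕ
  h = half m (+ n)
  n≤m : n ≤ m
  n≤m = ≤-trans (m≤n+m n 2) 2+n≤m
  2+n-odd : (2 + n) % 2 ≡ 1
  2+n-odd = trans ([2+n]%2≡n%2 n) n-odd
  h′≡1+h : half m (+ (2 + n)) ≡ suc h
  h′≡1+h = double-injective (begin-equality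
    half m (+ (2 + n)) + half m (+ (2 + n)) ≡⟨ half-+ m (2 + n) m-odd 2+n-odd ⟩
    m + (2 + n)                             ≡⟨ +-suc m (suc n) ⟩
    suc (m + suc n)                         ≡⟨ cong suc (+-suc m n) ⟩
    suc (suc (m + n))                       ≡⟨ cong (λ x → suc (suc x)) (half-+ m n m-odd n-odd) ⟨
    suc (suc (h + h))                       ≡⟨ cong suc (+-suc h h) ⟨
    suc h + suc h                           ∎)
  m<2h : suc m ≤ h + h
  m<2h = begin
    suc m  ≡⟨ +-comm 1 m ⟩
    m + 1  ≤⟨ +-monoʳ-≤ m (odd⇒pos n-odd) ⟩
    m + n  ≡⟨ half-+ m n m-odd n-odd ⟨
    h + h  ∎

a-ratio-chain : ∀ m n → m % 2 ≡ 1 → n % 2 ≡ 1 → n ≤ m →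
  a m (+ n) * (m C half m (+ 1)) ≤ a m (+ 1) * (m C half m (+ n))
a-ratio-chain m n m-odd n-odd n≤m = begin
  a m (+ n) * (m C h₁)             ≡⟨ cong₂ _*_ (a≡extensions-half m (+ n) m-odd n-odd n≤m) (sym (binom≡C m h₁)) ⟩
  extensions m h * binom m h₁      ≤⟨ ratio-chain (extensions m) (binom m) h₁ m step (binom-pos m) (≤⇒≤′ h₁≤h) h≤m ⟩
  extensions m h₁ * binom m h      ≡⟨ cong₂ _*_ (sym (a≡extensions-half m (+ 1) m-odd refl (odd⇒pos m-odd))) (binom≡C m h) ⟩
  a m (+ 1) * (m C h)              ∎
  where
  open ≤-Reasoning
  h₁ h : ℕ
  h₁ = half m (+ 1)
  h = half m (+ n)
  2h₁≡m+1 : h₁ + h₁ ≡ m + 1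
  2h₁≡m+1 = half-+ m 1 m-odd refl
  2h≡m+n : h + h ≡ m + n
  2h≡m+n = half-+ m n m-odd n-odd
  h₁≤h : h₁ ≤ h
  h₁≤h = m+m≤n+n⇒m≤n (subst₂ _≤_ (sym 2h₁≡m+1) (sym 2h≡m+n) (+-monoʳ-≤ m (odd⇒pos n-odd)))
  h≤m : h ≤ m
  h≤m = m+m≤n+n⇒m≤n (subst (_≤ m + m) (sym 2h≡m+n) (+-monoʳ-≤ m n≤m))
  step : ∀ h′ → h₁ ≤ h′ → h′ < m → extensions m (suc h′) * binom m h′ ≤ extensions m h′ * binom m (suc h′)
  step h′ h₁≤h′ _ = extensions-ratio m h′ (subst (_≤ h′ + h′) (trans 2h₁≡m+1 (+-comm m 1)) (+-mono-≤ h₁≤h′ h₁≤h′))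

a-regular-tournaments : ∀ m → m % 2 ≡ 1 →
  a m (+ 1) * (suc m C (suc m / 2)) ≡ RT (suc (suc m)) * (m C half m (+ 1))
a-regular-tournaments m m-odd with odd-double m m-odd
... | k , refl = begin
  a m (+ 1) * (suc m C (suc m / 2))
    ≡⟨ cong₂ _*_ (trans (a≡extensions-half m (+ 1) m-odd refl (odd⇒pos m-odd)) (cong (extensions m) h₁≡1+k))
                 (cong (suc m C_) [1+m]/2≡1+k) ⟩
  extensions m (suc k) * (suc m C suc k)
    ≡⟨ cong (extensions m (suc k) *_) (nCk+nC[k+1]≡[n+1]C[k+1] m k) ⟨
  extensions m (suc k) * (m C k + m C suc k)
    ≡⟨ cong (λ x → extensions m (suc k) * (x + m C suc k)) C-middle ⟩
  extensions m (suc k) * (m C suc k + m C suc k)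
    ≡⟨ double-* (extensions m (suc k)) (m C suc k) ⟩
  (extensions m (suc k) + extensions m (suc k)) * (m C suc k)
    ≡⟨ cong₂ _*_ RT≡2ext (cong (m C_) h₁≡1+k) ⟨
  RT (suc (suc m)) * (m C half m (+ 1)) ∎
  where
  open ≡-Reasoning
  h₁≡1+k : half m (+ 1) ≡ suc k
  h₁≡1+k = double-injective
    (trans (half-+ m 1 m-odd refl) (trans (cong suc (+-comm (k + k) 1)) (cong suc (sym (+-suc k k)))))
  double : ∀ x → x * 2 ≡ x + x
  double = solve-∀
  [1+m]/2≡1+k : suc m / 2 ≡ suc k
  [1+m]/2≡1+k = trans (cong (_/ 2) (trans (cong suc (sym (+-suc k k))) (sym (double (suc k))))) (m*n/n≡m (suc k) 2)
  C-middle : m C k ≡ m C suc k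
  C-middle = trans (sym (binom≡C m k)) (trans (binom-sym′ m k (suc k) (+-suc k k)) (binom≡C m (suc k)))
  RT≡2ext : RT (suc (suc m)) ≡ extensions m (suc k) + extensions m (suc k)
  RT≡2ext = trans (RT≡extensions m k refl) (cong (_+ extensions m (suc k)) (extensions-sym m k (suc k) (+-suc k k)))
  double-* : ∀ x c → x * (c + c) ≡ (x + x) * c
  double-* = solve-∀

lemma7p5 : (m : ℕ) (f : ℤ) → m % 2 ≡ 1 → ∣ f ∣ % 2 ≡ 1 → ∣ f ∣ ≤ m →
    (a m (- f) ≡ a m f)
    × (+ 3 ℤ.≤ f →
        (a m f * (m C half m (f - + 2)) ≤ a m (f - + 2) * (m C half m f))
        × (a m (f - + 2) * (m C half m (+ 1)) ≤ a m (+ 1) * (m C half m (f - + 2)))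
        × (a m (+ 1) * (suc m C (suc m / 2)) ≡ RT (suc (suc m)) * (m C half m (+ 1))))
lemma7p5 m f m-odd f-odd f≤m = a-neg m f m-odd f-odd f≤m , λ where
  (ℤ.+≤+ {n = suc (suc (suc n))} (s≤s (s≤s (s≤s _)))) →
    let n-odd = trans (sym ([2+n]%2≡n%2 (suc n))) f-odd in
    a-ratio-step m (suc n) m-odd n-odd f≤m ,
    a-ratio-chain m (suc n) m-odd n-odd (≤-trans (m≤n+m (suc n) 2) f≤m) ,
    a-regular-tournaments m m-odd
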